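{- Let $(\varphi_j)_{j\ge0}$ be non-negative numbers with $\varphi_0>0$ and $\varphi(t)=\sum_j\varphi_jt^j$. For $m\ge1$ let $T_m$ be the total weight of unilabelled-bilabelled increasing trees with label set $\{1,\dots,m\}$, i.e. the sum of $w(T)=\prod_{v\in T}\varphi_{\mathrm{outdeg}(v)}$ over all pairs consisting of an ordered tree $T$ and an increasing unilabelled-bilabelled labelling of $T$ with label set $\{1,\dots,m\}$; let $T(z)=\sum_{m\ge1}T_m\frac{z^m}{m!}$. Then \[T''(z)=\varphi(T(z))+T'(z)\,\varphi'(T(z)),\qquad T(0)=0,\quad T'(0)=\varphi_0.\]
   Context: Ordered trees are rooted trees whose children of each node are linearly ordered; $\mathrm{outdeg}(v)$ is the number of children of $v$. An increasing unilabelled-bilabelled labelling of a tree $T$ with label set $\{1,\dots,m\}$ assigns to each node a set of either one or two labels, these sets partitioning $\{1,\dots,m\}$ (so $|T|\le m\le 2|T|$), such that every label of a child is larger than every label of its parent.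
   Formalization: The numbers $(\varphi_j)_{j\ge0}$ are taken to be non-negative rationals, with $\varphi_0>0$ kept. -}

module Defs where

open import Data.Nat as ℕ using (ℕ; zero; suc; _!)
open import Data.Nat.Properties using (_!≢0)
open import Data.Integer using (+_)
open import Data.Rational using (ℚ; 0ℚ; 1ℚ; _+_; _*_; _/_; _≤_; _<_)
open import Data.Fin as Fin using (Fin)
open import Data.List using (List; []; _∷_; length; map; foldr)
open import Data.List.Relation.Unary.Any using (Any; here; there)
open import Data.List.Relation.Unary.All using (All)
open import Data.List.Relation.Unary.Unique.Propositional using (Unique)
open import Data.List.Membership.Propositional using (_∈_)
open import Data.Vec using (Vec; lookup)
open import Data.Product using (Σ; ∃; ∃-syntax; _×_; _,_; proj₁)
open import Data.Sum using (_⊎_)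
open import Data.Empty using (⊥)
open import Data.Unit using (⊤)
open import Relation.Binary.PropositionalEquality using (_≡_; _≢_)

data Tree : Set where
  node : List Tree → Tree

-- Nodes (positions) of a tree: the root, or a node inside the i-th subtree.
data Pos : Tree → Set where
  root  : ∀ {ts} → Pos (node ts)
  below : ∀ {ts} → Any Pos ts → Pos (node ts)

-- Child u v : v is a child of u.
mutual
  Child : ∀ {t} → Pos t → Pos t → Set
  Child root root = ⊥
  Child root (below q) = IsSubRoot q
  Child (below p) root = ⊥
  Child (below p) (below q) = ChildAny p q

  IsSubRoot : ∀ {ts} → Any Pos ts → Set
  IsSubRoot (here root) = ⊤
  IsSubRoot (here (below _)) = ⊥
  IsSubRoot (there q) = IsSubRoot q

  ChildAny : ∀ {ts} → Any Pos ts → Any Pos ts → Set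
  ChildAny (here p) (here q) = Child p q
  ChildAny (here p) (there q) = ⊥
  ChildAny (there p) (here q) = ⊥
  ChildAny (there p) (there q) = ChildAny p q

mutual
  weight : (ℕ → ℚ) → Tree → ℚ
  weight φ (node ts) = φ (length ts) * weightForest φ ts

  weightForest : (ℕ → ℚ) → List Tree → ℚ
  weightForest φ [] = 1ℚ
  weightForest φ (t ∷ ts) = weight φ t * weightForest φ ts

-- Label i+1 (i : Fin m) is given to the node  lookup v i ; the label sets
-- of the nodes are the fibres of this assignment, so they partition the
-- label set automatically.

OneOrTwoLabels : ∀ {m t} → Vec (Pos t) m → Pos t → Set
OneOrTwoLabels {m} v u =
  (Σ (Fin m) λ i → lookup v i ≡ u × (∀ k → lookup v k ≡ u → k ≡ i))
  ⊎ (Σ (Fin m) λ i → Σ (Fin m) λ j → i ≢ j × lookup v i ≡ u × lookup v j ≡ u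
       × (∀ k → lookup v k ≡ u → k ≡ i ⊎ k ≡ j))

Increasing : ∀ {m t} → Vec (Pos t) m → Set
Increasing {m} v = ∀ (i j : Fin m) → Child (lookup v i) (lookup v j) → i Fin.< j

IsUBLabelling : ∀ {m t} → Vec (Pos t) m → Set
IsUBLabelling v = (∀ u → OneOrTwoLabels v u) × Increasing v

LTree : ℕ → Set
LTree m = Σ Tree λ t → Vec (Pos t) m

Valid : ∀ {m} → LTree m → Set
Valid (t , v) = IsUBLabelling v

sumℚ : List ℚ → ℚ
sumℚ = foldr _+_ 0ℚ

IsTotalWeight : (ℕ → ℚ) → ℕ → ℚ → Set
IsTotalWeight φ m x =
  ∃[ L ] (All Valid L × Unique L × (∀ p → Valid {m} p → p ∈ L)
          × x ≡ sumℚ (map (λ p → weight φ (proj₁ p)) L))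

FPS : Set
FPS = ℕ → ℚ

sumUpTo : ℕ → (ℕ → ℚ) → ℚ
sumUpTo zero f = f 0
sumUpTo (suc n) f = sumUpTo n f + f (suc n)

_⊛_ : FPS → FPS → FPS
(f ⊛ g) n = sumUpTo n (λ k → f k * g (n ℕ.∸ k))

one : FPS
one zero = 1ℚ
one (suc _) = 0ℚ

pow : FPS → ℕ → FPS
pow f zero = one
pow f (suc j) = f ⊛ pow f j

deriv : FPS → FPS
deriv f n = ((+ suc n) / 1) * f (suc n)

-- composition φ(f) = Σ_j φ_j f^j, for f with zero constant term
-- (then f^j has no terms below z^j, so only j ≤ n contribute to [z^n]).
compose : FPS → FPS → FPS
compose φ f n = sumUpTo n (λ j → φ j * pow f j n)

egf : (ℕ → ℚ) → FPS
egf T zero = 0ℚ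
egf T (suc m) = T (suc m) * ((+ 1) / (suc m !)) {{suc m !≢0}}

{-# OPTIONS --safe #-}
-- Children carry larger labels than their parents, so the root of a labelled tree carries label 1, and also
-- label 2 when it is bilabelled. Removing the root leaves an ordered forest of k labelled trees, and a labelled
-- forest is a shuffle of the labels of its trees, so the forests of k trees on n labels weigh n! [zⁿ] T(z)ᵏ.
-- Weighting the root by φ_k therefore gives T₁ = φ₀ and T_{n+2} = (n+1)! [zⁿ⁺¹] φ(T(z)) + n! [zⁿ] φ(T(z)),
-- that is T″ = φ(T) + (φ(T))′, and the chain rule turns (φ(T))′ into T′ φ′(T).
module Submission where

open import Defs
open import Data.Bool using (Bool; true; false)
open import Data.Empty using (⊥-elim)
open import Data.Fin as Fin using (Fin; zero; suc)
import Data.Fin.Properties as Fin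
open import Data.Integer as ℤ using (1ℤ)
import Data.Integer.Properties as ℤ
open import Data.List as List using (List; []; _∷_; _++_; length)
import Data.List.Properties as List
open import Data.List.Membership.Propositional using (_∈_)
import Data.List.Membership.Propositional.Properties as ∈
open import Data.List.Membership.Propositional.Properties.WithK using (unique∧set⇒bag)
open import Data.List.Relation.Binary.BagAndSetEquality using (∼bag⇒↭)
open import Data.List.Relation.Binary.Permutation.Propositional using (_↭_; ↭⇒↭ₛ)
import Data.List.Relation.Binary.Permutation.Propositional.Properties as ↭
import Data.List.Relation.Binary.Permutation.Setoid.Properties as ↭ₛ
open import Data.List.Relation.Unary.All as All using (All; []; _∷_)
import Data.List.Relation.Unary.All.Properties as All
open import Data.List.Relation.Unary.AllPairs using ([]; _∷_)
open import Data.List.Relation.Unary.Any using (Any; here; there)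
open import Data.List.Relation.Unary.Unique.Propositional using (Unique)
import Data.List.Relation.Unary.Unique.Propositional.Properties as Unique
open import Data.Nat as ℕ using (ℕ; zero; suc; _!; _∸_; z≤n; s≤s; NonZero)
open import Data.Nat.Properties using (_!≢0)
import Data.Nat.Properties as ℕ
open import Data.Product using (Σ; _×_; _,_; proj₁; proj₂)
open import Data.Product.Properties.WithK using (,-injectiveʳ)
open import Data.Rational using (ℚ; 0ℚ; 1ℚ; _+_; _*_; _/_; _≤_; _<_; toℚᵘ)
open import Data.Rational.Properties
  using ( toℚᵘ-injective; toℚᵘ-fromℚᵘ; toℚᵘ-homo-+; toℚᵘ-homo-*; +-0-isCommutativeMonoid
        ; +-identityˡ; +-identityʳ; +-comm; +-assoc; *-identityˡ; *-identityʳ; *-zeroˡ; *-zeroʳ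
        ; *-comm; *-assoc; *-distribˡ-+; *-distribʳ-+ )
open import Data.Rational.Solver using (module +-*-Solver)
import Data.Rational.Unnormalised as ℚᵘ
import Data.Rational.Unnormalised.Properties as ℚᵘ
open import Data.Sum using (_⊎_; inj₁; inj₂)
open import Data.Unit using (⊤; tt)
open import Data.Vec as Vec using (Vec; []; _∷_; lookup; count)
import Data.Vec.Properties as Vec
open import Data.Vec.Relation.Unary.All as Vecᴬ using ([]; _∷_) renaming (All to AllV)
import Data.Vec.Relation.Unary.All.Properties as Vecᴬ
open import Function using (_∘_)
open import Function.Bundles using (mk⇔)
open import Relation.Binary.Definitions using (DecidableEquality)
open import Relation.Binary.PropositionalEquality
open import Relation.Nullary using (¬_; yes; no)
open import Relation.Nullary.Decidable using (map′)

open +-*-Solver using (solve; _:=_; _:+_; _:*_; con)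
open ≡-Reasoning

-- Natural numbers and factorials in ℚ

fromℕ : ℕ → ℚ
fromℕ n = ℤ.+ n / 1

toℚᵘ-fromℕ : ∀ n → toℚᵘ (fromℕ n) ℚᵘ.≃ ℚᵘ.mkℚᵘ (ℤ.+ n) 0
toℚᵘ-fromℕ n = toℚᵘ-fromℚᵘ (ℚᵘ.mkℚᵘ (ℤ.+ n) 0)

fromℕ-+ : ∀ m n → fromℕ (m ℕ.+ n) ≡ fromℕ m + fromℕ n
fromℕ-+ m n = toℚᵘ-injective
  (ℚᵘ.≃-trans (toℚᵘ-fromℕ (m ℕ.+ n)) (ℚᵘ.≃-trans (ℚᵘ.*≡* cross) (ℚᵘ.≃-sym
  (ℚᵘ.≃-trans (toℚᵘ-homo-+ (fromℕ m) (fromℕ n)) (ℚᵘ.+-cong (toℚᵘ-fromℕ m) (toℚᵘ-fromℕ n))))))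
  where
  cross : ℤ.+ (m ℕ.+ n) ℤ.* 1ℤ ≡ (ℤ.+ m ℤ.* 1ℤ ℤ.+ ℤ.+ n ℤ.* 1ℤ) ℤ.* 1ℤ
  cross = cong (ℤ._* 1ℤ) (trans (ℤ.pos-+ m n)
    (sym (cong₂ ℤ._+_ (ℤ.*-identityʳ (ℤ.+ m)) (ℤ.*-identityʳ (ℤ.+ n)))))

fromℕ-* : ∀ m n → fromℕ (m ℕ.* n) ≡ fromℕ m * fromℕ n
fromℕ-* m n = toℚᵘ-injective
  (ℚᵘ.≃-trans (toℚᵘ-fromℕ (m ℕ.* n)) (ℚᵘ.≃-trans (ℚᵘ.*≡* cross) (ℚᵘ.≃-sym
  (ℚᵘ.≃-trans (toℚᵘ-homo-* (fromℕ m) (fromℕ n)) (ℚᵘ.*-cong (toℚᵘ-fromℕ m) (toℚᵘ-fromℕ n))))))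
  where
  cross : ℤ.+ (m ℕ.* n) ℤ.* 1ℤ ≡ (ℤ.+ m ℤ.* ℤ.+ n) ℤ.* 1ℤ
  cross = cong (ℤ._* 1ℤ) (ℤ.pos-* m n)

1/n*n≡1 : ∀ n .{{_ : NonZero n}} → (ℤ.+ 1 / n) * fromℕ n ≡ 1ℚ
1/n*n≡1 (suc n) = toℚᵘ-injective
  (ℚᵘ.≃-trans (toℚᵘ-homo-* (ℤ.+ 1 / suc n) (fromℕ (suc n)))
  (ℚᵘ.≃-trans (ℚᵘ.*-cong (toℚᵘ-fromℚᵘ (ℚᵘ.mkℚᵘ (ℤ.+ 1) n)) (toℚᵘ-fromℕ (suc n))) (ℚᵘ.*≡* cross)))
  where
  cross : (1ℤ ℤ.* ℤ.+ suc n) ℤ.* 1ℤ ≡ 1ℤ ℤ.* (ℤ.+ suc n ℤ.* 1ℤ)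
  cross = ℤ.*-assoc 1ℤ (ℤ.+ suc n) 1ℤ

-- The factor 1/k! exactly as egf writes it, so that egf T (suc k) ≡ T (suc k) * invFact (suc k) is refl.
invFact : ℕ → ℚ
invFact k = (ℤ.+ 1 / (k !)) {{k !≢0}}

invFact-inverse : ∀ k → invFact k * fromℕ (k !) ≡ 1ℚ
invFact-inverse k = 1/n*n≡1 (k !) {{k !≢0}}

fromℕ-! : ∀ k → fromℕ (suc k !) ≡ fromℕ (suc k) * fromℕ (k !)
fromℕ-! k = fromℕ-* (suc k) (k !)

invFact-suc : ∀ k → invFact k ≡ fromℕ (suc k) * invFact (suc k)
invFact-suc k = begin
  invFact k                                          ≡⟨ *-identityʳ (invFact k) ⟨
  invFact k * 1ℚ                                     ≡⟨ cong (invFact k *_) (invFact-inverse (suc k)) ⟨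
  invFact k * (invFact (suc k) * fromℕ (suc k !))    ≡⟨ cong (λ z → invFact k * (invFact (suc k) * z)) (fromℕ-! k) ⟩
  invFact k * (invFact (suc k) * (n * fromℕ (k !)))  ≡⟨ solve 4 (λ i j n f → i :* (j :* (n :* f)) := (i :* f) :* (n :* j))
                                                          refl (invFact k) (invFact (suc k)) n (fromℕ (k !)) ⟩
  (invFact k * fromℕ (k !)) * (n * invFact (suc k))  ≡⟨ cong (_* (n * invFact (suc k))) (invFact-inverse k) ⟩
  1ℚ * (n * invFact (suc k))                         ≡⟨ *-identityˡ _ ⟩
  n * invFact (suc k)                                ∎
  where n = fromℕ (suc k)

deriv-deriv-egf : ∀ T n → deriv (deriv (egf T)) n ≡ T (suc (suc n)) * invFact n
deriv-deriv-egf T n = begin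
  a * (b * (t * invFact (suc (suc n))))   ≡⟨ solve 4 (λ a b t i → a :* (b :* (t :* i)) := t :* (a :* (b :* i)))
                                               refl a b t (invFact (suc (suc n))) ⟩
  t * (a * (b * invFact (suc (suc n))))   ≡⟨ cong (λ x → t * (a * x)) (invFact-suc (suc n)) ⟨
  t * (a * invFact (suc n))               ≡⟨ cong (t *_) (invFact-suc n) ⟨
  t * invFact n                           ∎
  where
  a = fromℕ (suc n)
  b = fromℕ (suc (suc n))
  t = T (suc (suc n))

-- Finite sums

sumUpTo-cong : ∀ n {f g : ℕ → ℚ} → (∀ k → k ℕ.≤ n → f k ≡ g k) → sumUpTo n f ≡ sumUpTo n g
sumUpTo-cong zero    f≗g = f≗g 0 z≤n
sumUpTo-cong (suc n) f≗g =
  cong₂ _+_ (sumUpTo-cong n (λ k k≤n → f≗g k (ℕ.m≤n⇒m≤1+n k≤n))) (f≗g (suc n) ℕ.≤-refl)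

sumUpTo-+ : ∀ n (f g : ℕ → ℚ) → sumUpTo n (λ k → f k + g k) ≡ sumUpTo n f + sumUpTo n g
sumUpTo-+ zero    f g = refl
sumUpTo-+ (suc n) f g = trans (cong (_+ (f (suc n) + g (suc n))) (sumUpTo-+ n f g))
  (solve 4 (λ a b c d → (a :+ b) :+ (c :+ d) := (a :+ c) :+ (b :+ d)) refl
     (sumUpTo n f) (sumUpTo n g) (f (suc n)) (g (suc n)))

*-distribˡ-sumUpTo : ∀ n c (f : ℕ → ℚ) → c * sumUpTo n f ≡ sumUpTo n (λ k → c * f k)
*-distribˡ-sumUpTo zero    c f = refl
*-distribˡ-sumUpTo (suc n) c f =
  trans (*-distribˡ-+ c (sumUpTo n f) (f (suc n))) (cong (_+ c * f (suc n)) (*-distribˡ-sumUpTo n c f))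

*-distribʳ-sumUpTo : ∀ n c (f : ℕ → ℚ) → sumUpTo n f * c ≡ sumUpTo n (λ k → f k * c)
*-distribʳ-sumUpTo n c f = trans (*-comm (sumUpTo n f) c)
  (trans (*-distribˡ-sumUpTo n c f) (sumUpTo-cong n (λ k _ → *-comm c (f k))))

sumUpTo-suc : ∀ n (f : ℕ → ℚ) → sumUpTo (suc n) f ≡ f 0 + sumUpTo n (λ k → f (suc k))
sumUpTo-suc zero    f = refl
sumUpTo-suc (suc n) f = trans (cong (_+ f (suc (suc n))) (sumUpTo-suc n f)) (+-assoc (f 0) _ _)

sumUpTo-zero : ∀ n (f : ℕ → ℚ) → (∀ k → k ℕ.≤ n → f k ≡ 0ℚ) → sumUpTo n f ≡ 0ℚ
sumUpTo-zero n f f≡0 = trans (sumUpTo-cong n f≡0) (const-zero n)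
  where
  const-zero : ∀ n → sumUpTo n (λ _ → 0ℚ) ≡ 0ℚ
  const-zero zero    = refl
  const-zero (suc n) = trans (+-identityʳ _) (const-zero n)

sumUpTo-reverse : ∀ n (f : ℕ → ℚ) → sumUpTo n f ≡ sumUpTo n (λ k → f (n ∸ k))
sumUpTo-reverse zero    f = refl
sumUpTo-reverse (suc n) f = begin
  sumUpTo n f + f (suc n)                    ≡⟨ cong (_+ f (suc n)) (sumUpTo-reverse n f) ⟩
  sumUpTo n (λ k → f (n ∸ k)) + f (suc n)    ≡⟨ +-comm _ (f (suc n)) ⟩
  f (suc n) + sumUpTo n (λ k → f (n ∸ k))    ≡⟨ sumUpTo-suc n (λ k → f (suc n ∸ k)) ⟨
  sumUpTo (suc n) (λ k → f (suc n ∸ k))      ∎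

sumUpTo-comm : ∀ m n (F : ℕ → ℕ → ℚ) →
               sumUpTo m (λ k → sumUpTo n (F k)) ≡ sumUpTo n (λ j → sumUpTo m (λ k → F k j))
sumUpTo-comm zero    n F = refl
sumUpTo-comm (suc m) n F = trans (cong (_+ sumUpTo n (F (suc m))) (sumUpTo-comm m n F))
  (sym (sumUpTo-+ n (λ j → sumUpTo m (λ k → F k j)) (F (suc m))))

sumUpTo-triangle : ∀ n (F : ℕ → ℕ → ℚ) →
  sumUpTo n (λ k → sumUpTo (n ∸ k) (F k)) ≡ sumUpTo n (λ m → sumUpTo m (λ k → F k (m ∸ k)))
sumUpTo-triangle zero    F = refl
sumUpTo-triangle (suc n) F = begin
  sumUpTo n (λ k → sumUpTo (suc n ∸ k) (F k)) + sumUpTo (n ∸ n) (F (suc n))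
    ≡⟨ cong₂ _+_ (sumUpTo-cong n peel) single ⟩
  sumUpTo n (λ k → sumUpTo (n ∸ k) (F k) + F k (suc n ∸ k)) + F (suc n) (n ∸ n)
    ≡⟨ cong (_+ F (suc n) (n ∸ n)) (sumUpTo-+ n (λ k → sumUpTo (n ∸ k) (F k)) (λ k → F k (suc n ∸ k))) ⟩
  (sumUpTo n (λ k → sumUpTo (n ∸ k) (F k)) + sumUpTo n (λ k → F k (suc n ∸ k))) + F (suc n) (n ∸ n)
    ≡⟨ +-assoc (sumUpTo n (λ k → sumUpTo (n ∸ k) (F k))) _ _ ⟩
  sumUpTo n (λ k → sumUpTo (n ∸ k) (F k)) + sumUpTo (suc n) (λ k → F k (suc n ∸ k))
    ≡⟨ cong (_+ sumUpTo (suc n) (λ k → F k (suc n ∸ k))) (sumUpTo-triangle n F) ⟩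
  sumUpTo n (λ m → sumUpTo m (λ k → F k (m ∸ k))) + sumUpTo (suc n) (λ k → F k (suc n ∸ k)) ∎
  where
  peel : ∀ k → k ℕ.≤ n → sumUpTo (suc n ∸ k) (F k) ≡ sumUpTo (n ∸ k) (F k) + F k (suc n ∸ k)
  peel k k≤n rewrite ℕ.+-∸-assoc 1 k≤n = refl
  single : sumUpTo (n ∸ n) (F (suc n)) ≡ F (suc n) (n ∸ n)
  single rewrite ℕ.n∸n≡0 n = refl

sumUpTo-extend : ∀ m n (f : ℕ → ℚ) → m ℕ.≤ n → (∀ k → m ℕ.< k → f k ≡ 0ℚ) → sumUpTo n f ≡ sumUpTo m f
sumUpTo-extend m n f m≤n f≡0 = trans (cong (λ z → sumUpTo z f) (sym (ℕ.m∸n+n≡m m≤n))) (pad (n ∸ m))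
  where
  pad : ∀ d → sumUpTo (d ℕ.+ m) f ≡ sumUpTo m f
  pad zero    = refl
  pad (suc d) = trans (cong₂ _+_ (pad d) (f≡0 (suc (d ℕ.+ m)) (s≤s (ℕ.m≤n+m m d)))) (+-identityʳ _)

-- Formal power series

⊛-congˡ : ∀ {f f′ : FPS} g → f ≗ f′ → f ⊛ g ≗ f′ ⊛ g
⊛-congˡ g f≗f′ n = sumUpTo-cong n (λ k _ → cong (_* g (n ∸ k)) (f≗f′ k))

⊛-congʳ : ∀ f {g g′ : FPS} → g ≗ g′ → f ⊛ g ≗ f ⊛ g′
⊛-congʳ f g≗g′ n = sumUpTo-cong n (λ k _ → cong (f k *_) (g≗g′ (n ∸ k)))

⊛-comm : ∀ (f g : FPS) → f ⊛ g ≗ g ⊛ f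
⊛-comm f g n = trans (sumUpTo-reverse n _) (sumUpTo-cong n swap)
  where
  swap : ∀ k → k ℕ.≤ n → f (n ∸ k) * g (n ∸ (n ∸ k)) ≡ g k * f (n ∸ k)
  swap k k≤n rewrite ℕ.m∸[m∸n]≡n k≤n = *-comm (f (n ∸ k)) (g k)

⊛-assoc : ∀ (f g h : FPS) → (f ⊛ g) ⊛ h ≗ f ⊛ (g ⊛ h)
⊛-assoc f g h n = begin
  sumUpTo n (λ m → sumUpTo m (λ k → f k * g (m ∸ k)) * h (n ∸ m))
    ≡⟨ sumUpTo-cong n (λ m _ → *-distribʳ-sumUpTo m (h (n ∸ m)) (λ k → f k * g (m ∸ k))) ⟩
  sumUpTo n (λ m → sumUpTo m (λ k → f k * g (m ∸ k) * h (n ∸ m)))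
    ≡⟨ sumUpTo-cong n (λ m m≤n → sumUpTo-cong m (λ k k≤m → reassociate m k k≤m m≤n)) ⟩
  sumUpTo n (λ m → sumUpTo m (λ k → f k * (g (m ∸ k) * h ((n ∸ k) ∸ (m ∸ k)))))
    ≡⟨ sumUpTo-triangle n (λ k i → f k * (g i * h ((n ∸ k) ∸ i))) ⟨
  sumUpTo n (λ k → sumUpTo (n ∸ k) (λ i → f k * (g i * h ((n ∸ k) ∸ i))))
    ≡⟨ sumUpTo-cong n (λ k _ → *-distribˡ-sumUpTo (n ∸ k) (f k) (λ i → g i * h ((n ∸ k) ∸ i))) ⟨
  sumUpTo n (λ k → f k * sumUpTo (n ∸ k) (λ i → g i * h ((n ∸ k) ∸ i))) ∎
  where
  reassociate : ∀ m k → k ℕ.≤ m → m ℕ.≤ n →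
                f k * g (m ∸ k) * h (n ∸ m) ≡ f k * (g (m ∸ k) * h ((n ∸ k) ∸ (m ∸ k)))
  reassociate m k k≤m m≤n
    rewrite ℕ.∸-+-assoc n k (m ∸ k) | ℕ.m+[n∸m]≡n k≤m = *-assoc (f k) (g (m ∸ k)) (h (n ∸ m))

⊛-scaleʳ : ∀ (f g : FPS) c → f ⊛ (λ k → c * g k) ≗ (λ n → c * (f ⊛ g) n)
⊛-scaleʳ f g c n = trans (sumUpTo-cong n (λ k _ → commute (f k) (g (n ∸ k))))
  (sym (*-distribˡ-sumUpTo n c _))
  where
  commute : ∀ a b → a * (c * b) ≡ c * (a * b)
  commute a b = solve 3 (λ a b c → a :* (c :* b) := c :* (a :* b)) refl a b c

⊛-zeroʳ : ∀ (f g : FPS) → (∀ k → g k ≡ 0ℚ) → ∀ n → (f ⊛ g) n ≡ 0ℚ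
⊛-zeroʳ f g g≡0 n = sumUpTo-zero n _ (λ k _ → trans (cong (f k *_) (g≡0 (n ∸ k))) (*-zeroʳ (f k)))

deriv-⊛ : ∀ (f g : FPS) n → deriv (f ⊛ g) n ≡ (deriv f ⊛ g) n + (f ⊛ deriv g) n
deriv-⊛ f g n = begin
  fromℕ (suc n) * sumUpTo (suc n) (λ k → f k * g (suc n ∸ k))
    ≡⟨ *-distribˡ-sumUpTo (suc n) (fromℕ (suc n)) _ ⟩
  sumUpTo (suc n) (λ k → fromℕ (suc n) * (f k * g (suc n ∸ k)))
    ≡⟨ sumUpTo-cong (suc n) split ⟩
  sumUpTo (suc n) (λ k → fromℕ k * (f k * g (suc n ∸ k)) + fromℕ (suc n ∸ k) * (f k * g (suc n ∸ k)))
    ≡⟨ sumUpTo-+ (suc n) _ _ ⟩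
  sumUpTo (suc n) (λ k → fromℕ k * (f k * g (suc n ∸ k)))
    + sumUpTo (suc n) (λ k → fromℕ (suc n ∸ k) * (f k * g (suc n ∸ k)))
    ≡⟨ cong₂ _+_ differentiate-f differentiate-g ⟩
  (deriv f ⊛ g) n + (f ⊛ deriv g) n ∎
  where
  split : ∀ k → k ℕ.≤ suc n → fromℕ (suc n) * (f k * g (suc n ∸ k))
          ≡ fromℕ k * (f k * g (suc n ∸ k)) + fromℕ (suc n ∸ k) * (f k * g (suc n ∸ k))
  split k k≤1+n = trans (cong (λ m → fromℕ m * (f k * g (suc n ∸ k))) (sym (ℕ.m+[n∸m]≡n k≤1+n)))
    (trans (cong (_* (f k * g (suc n ∸ k))) (fromℕ-+ k (suc n ∸ k))) (*-distribʳ-+ _ (fromℕ k) _))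
  differentiate-f : sumUpTo (suc n) (λ k → fromℕ k * (f k * g (suc n ∸ k))) ≡ (deriv f ⊛ g) n
  differentiate-f = begin
    sumUpTo (suc n) (λ k → fromℕ k * (f k * g (suc n ∸ k)))
      ≡⟨ sumUpTo-suc n _ ⟩
    fromℕ 0 * (f 0 * g (suc n)) + sumUpTo n (λ k → fromℕ (suc k) * (f (suc k) * g (n ∸ k)))
      ≡⟨ cong (_+ sumUpTo n (λ k → fromℕ (suc k) * (f (suc k) * g (n ∸ k)))) (*-zeroˡ (f 0 * g (suc n))) ⟩
    0ℚ + sumUpTo n (λ k → fromℕ (suc k) * (f (suc k) * g (n ∸ k)))
      ≡⟨ +-identityˡ (sumUpTo n (λ k → fromℕ (suc k) * (f (suc k) * g (n ∸ k)))) ⟩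
    sumUpTo n (λ k → fromℕ (suc k) * (f (suc k) * g (n ∸ k)))
      ≡⟨ sumUpTo-cong n (λ k _ → *-assoc (fromℕ (suc k)) (f (suc k)) (g (n ∸ k))) ⟨
    (deriv f ⊛ g) n ∎
  differentiate-g : sumUpTo (suc n) (λ k → fromℕ (suc n ∸ k) * (f k * g (suc n ∸ k))) ≡ (f ⊛ deriv g) n
  differentiate-g = begin
    S + fromℕ (n ∸ n) * (f (suc n) * g (n ∸ n))  ≡⟨ cong (S +_) (last-vanishes (f (suc n) * g (n ∸ n))) ⟩
    S + 0ℚ                                      ≡⟨ +-identityʳ S ⟩
    S                                           ≡⟨ sumUpTo-cong n commute ⟩
    (f ⊛ deriv g) n                             ∎
    where
    S = sumUpTo n (λ k → fromℕ (suc n ∸ k) * (f k * g (suc n ∸ k)))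
    last-vanishes : ∀ x → fromℕ (n ∸ n) * x ≡ 0ℚ
    last-vanishes x rewrite ℕ.n∸n≡0 n = *-zeroˡ x
    commute : ∀ k → k ℕ.≤ n → fromℕ (suc n ∸ k) * (f k * g (suc n ∸ k)) ≡ f k * deriv g (n ∸ k)
    commute k k≤n rewrite ℕ.+-∸-assoc 1 k≤n =
      solve 3 (λ a b c → a :* (b :* c) := b :* (a :* c)) refl (fromℕ (suc (n ∸ k))) (f k) (g (suc (n ∸ k)))

pow-vanishes : ∀ (f : FPS) → f 0 ≡ 0ℚ → ∀ j n → n ℕ.< j → pow f j n ≡ 0ℚ
pow-vanishes f f₀≡0 (suc j) n (s≤s n≤j) = sumUpTo-zero n _ term
  where
  term : ∀ k → k ℕ.≤ n → f k * pow f j (n ∸ k) ≡ 0ℚ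
  term zero    _ = trans (cong (_* pow f j n) f₀≡0) (*-zeroˡ (pow f j n))
  term (suc k) (s≤s k≤n-1) = trans (cong (f (suc k) *_) (pow-vanishes f f₀≡0 j (n ∸ suc k) n-1-k<j))
    (*-zeroʳ (f (suc k)))
    where
    n-1-k<j : n ∸ suc k ℕ.< j
    n-1-k<j = ℕ.<-≤-trans (ℕ.∸-monoʳ-< (s≤s z≤n) (s≤s k≤n-1)) n≤j

deriv-pow : ∀ (f : FPS) j n → deriv (pow f (suc j)) n ≡ fromℕ (suc j) * (deriv f ⊛ pow f j) n
deriv-pow f zero n = begin
  deriv (f ⊛ one) n                           ≡⟨ deriv-⊛ f one n ⟩
  (deriv f ⊛ one) n + (f ⊛ deriv one) n       ≡⟨ cong ((deriv f ⊛ one) n +_)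
                                                    (⊛-zeroʳ f (deriv one) (λ k → *-zeroʳ (fromℕ (suc k))) n) ⟩
  (deriv f ⊛ one) n + 0ℚ                      ≡⟨ +-identityʳ ((deriv f ⊛ one) n) ⟩
  (deriv f ⊛ one) n                           ≡⟨ *-identityˡ _ ⟨
  fromℕ 1 * (deriv f ⊛ one) n                 ∎
deriv-pow f (suc j) n = begin
  deriv (f ⊛ pow f (suc j)) n                    ≡⟨ deriv-⊛ f (pow f (suc j)) n ⟩
  X + (f ⊛ deriv (pow f (suc j))) n              ≡⟨ cong (X +_) (⊛-congʳ f {deriv (pow f (suc j))} (deriv-pow f j) n) ⟩
  X + (f ⊛ (λ k → i * (deriv f ⊛ pow f j) k)) n  ≡⟨ cong (X +_) (⊛-scaleʳ f (deriv f ⊛ pow f j) i n) ⟩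
  X + i * (f ⊛ (deriv f ⊛ pow f j)) n            ≡⟨ cong (λ z → X + i * z) exchange ⟩
  X + i * X                                      ≡⟨ solve 2 (λ x i → x :+ i :* x := (con 1ℚ :+ i) :* x) refl X i ⟩
  (1ℚ + i) * X                                   ≡⟨ cong (_* X) (fromℕ-+ 1 (suc j)) ⟨
  fromℕ (suc (suc j)) * X                        ∎
  where
  i = fromℕ (suc j)
  X = (deriv f ⊛ (f ⊛ pow f j)) n
  exchange : (f ⊛ (deriv f ⊛ pow f j)) n ≡ X
  exchange = begin
    (f ⊛ (deriv f ⊛ pow f j)) n   ≡⟨ ⊛-assoc f (deriv f) (pow f j) n ⟨
    ((f ⊛ deriv f) ⊛ pow f j) n   ≡⟨ ⊛-congˡ (pow f j) (⊛-comm f (deriv f)) n ⟩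
    ((deriv f ⊛ f) ⊛ pow f j) n   ≡⟨ ⊛-assoc (deriv f) f (pow f j) n ⟩
    X                             ∎

deriv-compose : ∀ (φ f : FPS) → f 0 ≡ 0ℚ → ∀ n → deriv (compose φ f) n ≡ (deriv f ⊛ compose (deriv φ) f) n
deriv-compose φ f f₀≡0 n = begin
  fromℕ (suc n) * sumUpTo (suc n) (λ j → φ j * pow f j (suc n))
    ≡⟨ *-distribˡ-sumUpTo (suc n) (fromℕ (suc n)) _ ⟩
  sumUpTo (suc n) (λ j → fromℕ (suc n) * (φ j * pow f j (suc n)))
    ≡⟨ sumUpTo-suc n _ ⟩
  fromℕ (suc n) * (φ 0 * 0ℚ) + sumUpTo n (λ j → fromℕ (suc n) * (φ (suc j) * pow f (suc j) (suc n)))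
    ≡⟨ cong₂ _+_ (trans (cong (fromℕ (suc n) *_) (*-zeroʳ (φ 0))) (*-zeroʳ (fromℕ (suc n))))
                 (sumUpTo-cong n (λ j _ → differentiate-term j)) ⟩
  0ℚ + sumUpTo n (λ j → deriv φ j * sumUpTo n (λ k → deriv f k * pow f j (n ∸ k)))
    ≡⟨ +-identityˡ _ ⟩
  sumUpTo n (λ j → deriv φ j * sumUpTo n (λ k → deriv f k * pow f j (n ∸ k)))
    ≡⟨ sumUpTo-cong n (λ j _ → *-distribˡ-sumUpTo n (deriv φ j) _) ⟩
  sumUpTo n (λ j → sumUpTo n (λ k → deriv φ j * (deriv f k * pow f j (n ∸ k))))
    ≡⟨ sumUpTo-comm n n _ ⟩
  sumUpTo n (λ k → sumUpTo n (λ j → deriv φ j * (deriv f k * pow f j (n ∸ k))))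
    ≡⟨ sumUpTo-cong n (λ k _ → factor-out k) ⟩
  sumUpTo n (λ k → deriv f k * sumUpTo n (λ j → deriv φ j * pow f j (n ∸ k)))
    ≡⟨ sumUpTo-cong n (λ k _ → cong (deriv f k *_) (truncate k)) ⟩
  sumUpTo n (λ k → deriv f k * sumUpTo (n ∸ k) (λ j → deriv φ j * pow f j (n ∸ k))) ∎
  where
  differentiate-term : ∀ j → fromℕ (suc n) * (φ (suc j) * pow f (suc j) (suc n))
                             ≡ deriv φ j * sumUpTo n (λ k → deriv f k * pow f j (n ∸ k))
  differentiate-term j = begin
    fromℕ (suc n) * (φ (suc j) * pow f (suc j) (suc n))
      ≡⟨ solve 3 (λ a b c → a :* (b :* c) := b :* (a :* c)) refl (fromℕ (suc n)) (φ (suc j)) (pow f (suc j) (suc n)) ⟩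
    φ (suc j) * deriv (pow f (suc j)) n
      ≡⟨ cong (φ (suc j) *_) (deriv-pow f j n) ⟩
    φ (suc j) * (fromℕ (suc j) * (deriv f ⊛ pow f j) n)
      ≡⟨ solve 3 (λ a b c → a :* (b :* c) := (b :* a) :* c) refl (φ (suc j)) (fromℕ (suc j)) ((deriv f ⊛ pow f j) n) ⟩
    deriv φ j * (deriv f ⊛ pow f j) n ∎
  factor-out : ∀ k → sumUpTo n (λ j → deriv φ j * (deriv f k * pow f j (n ∸ k)))
                     ≡ deriv f k * sumUpTo n (λ j → deriv φ j * pow f j (n ∸ k))
  factor-out k = trans (sumUpTo-cong n (λ j _ → solve 3 (λ a b c → a :* (b :* c) := b :* (a :* c))
                   refl (deriv φ j) (deriv f k) (pow f j (n ∸ k))))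
                 (sym (*-distribˡ-sumUpTo n (deriv f k) _))
  -- compose stops at j ≤ n, which loses nothing only because f 0 ≡ 0.
  truncate : ∀ k → sumUpTo n (λ j → deriv φ j * pow f j (n ∸ k))
                   ≡ sumUpTo (n ∸ k) (λ j → deriv φ j * pow f j (n ∸ k))
  truncate k = sumUpTo-extend (n ∸ k) n _ (ℕ.m∸n≤m n k)
    (λ j n-k<j → trans (cong (deriv φ j *_) (pow-vanishes f f₀≡0 j (n ∸ k) n-k<j)) (*-zeroʳ (deriv φ j)))

-- Shuffles

sumℚ-++ : ∀ xs ys → sumℚ (xs ++ ys) ≡ sumℚ xs + sumℚ ys
sumℚ-++ []       ys = sym (+-identityˡ (sumℚ ys))
sumℚ-++ (x ∷ xs) ys = trans (cong (x +_) (sumℚ-++ xs ys)) (sym (+-assoc x (sumℚ xs) (sumℚ ys)))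

*-distribˡ-sumℚ : ∀ {A : Set} c (f : A → ℚ) xs → c * sumℚ (List.map f xs) ≡ sumℚ (List.map (λ x → c * f x) xs)
*-distribˡ-sumℚ c f []       = *-zeroʳ c
*-distribˡ-sumℚ c f (x ∷ xs) = trans (*-distribˡ-+ c (f x) _) (cong (c * f x +_) (*-distribˡ-sumℚ c f xs))

allBoolVecs : ∀ n → List (Vec Bool n)
allBoolVecs zero    = [] ∷ []
allBoolVecs (suc n) = List.map (true ∷_) (allBoolVecs n) ++ List.map (false ∷_) (allBoolVecs n)

∈-allBoolVecs : ∀ {n} (s : Vec Bool n) → s ∈ allBoolVecs n
∈-allBoolVecs []          = here refl
∈-allBoolVecs (true ∷ s)  = ∈.∈-++⁺ˡ (∈.∈-map⁺ (true ∷_) (∈-allBoolVecs s))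
∈-allBoolVecs {suc n} (false ∷ s) =
  ∈.∈-++⁺ʳ (List.map (true ∷_) (allBoolVecs n)) (∈.∈-map⁺ (false ∷_) (∈-allBoolVecs s))

allBoolVecs-unique : ∀ n → Unique (allBoolVecs n)
allBoolVecs-unique zero    = [] ∷ []
allBoolVecs-unique (suc n) =
  Unique.++⁺ (Unique.map⁺ Vec.∷-injectiveʳ (allBoolVecs-unique n)) (Unique.map⁺ Vec.∷-injectiveʳ (allBoolVecs-unique n))
             heads-differ
  where
  heads-differ : ∀ {s} → ¬ (s ∈ List.map (true ∷_) (allBoolVecs n) × s ∈ List.map (false ∷_) (allBoolVecs n))
  heads-differ (s∈T , s∈F) with ∈.∈-map⁻ (true ∷_) s∈T | ∈.∈-map⁻ (false ∷_) s∈F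
  ... | _ , _ , refl | _ , _ , ()

trues : ∀ {n} → Vec Bool n → ℕ
trues []          = 0
trues (true ∷ s)  = suc (trues s)
trues (false ∷ s) = trues s

falses : ∀ {n} → Vec Bool n → ℕ
falses []          = 0
falses (true ∷ s)  = falses s
falses (false ∷ s) = suc (falses s)

trues+falses : ∀ {n} (s : Vec Bool n) → trues s ℕ.+ falses s ≡ n
trues+falses []          = refl
trues+falses (true ∷ s)  = cong suc (trues+falses s)
trues+falses (false ∷ s) = trans (ℕ.+-suc (trues s) (falses s)) (cong suc (trues+falses s))

-- Summing over the first entry of the vector is the Leibniz rule for exponential generating functions.
shuffle-sum : ∀ n (A B : ℕ → ℚ) (a b : FPS) →
              (∀ k → A k ≡ fromℕ (k !) * a k) → (∀ k → B k ≡ fromℕ (k !) * b k) →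
              sumℚ (List.map (λ s → A (trues s) * B (falses s)) (allBoolVecs n)) ≡ fromℕ (n !) * (a ⊛ b) n
shuffle-sum zero A B a b A≡ B≡ = begin
  A 0 * B 0 + 0ℚ                    ≡⟨ cong₂ (λ x y → x * y + 0ℚ) (A≡ 0) (B≡ 0) ⟩
  (1ℚ * a 0) * (1ℚ * b 0) + 0ℚ      ≡⟨ solve 2 (λ x y → (con 1ℚ :* x) :* (con 1ℚ :* y) :+ con 0ℚ := con 1ℚ :* (x :* y))
                                          refl (a 0) (b 0) ⟩
  1ℚ * (a 0 * b 0)                  ∎
shuffle-sum (suc n) A B a b A≡ B≡ = begin
  sumℚ (List.map w (List.map (true ∷_) Ss ++ List.map (false ∷_) Ss))
    ≡⟨ cong sumℚ (List.map-++ w (List.map (true ∷_) Ss) (List.map (false ∷_) Ss)) ⟩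
  sumℚ (List.map w (List.map (true ∷_) Ss) ++ List.map w (List.map (false ∷_) Ss))
    ≡⟨ sumℚ-++ (List.map w (List.map (true ∷_) Ss)) _ ⟩
  sumℚ (List.map w (List.map (true ∷_) Ss)) + sumℚ (List.map w (List.map (false ∷_) Ss))
    ≡⟨ cong₂ (λ xs ys → sumℚ xs + sumℚ ys) (List.map-∘ Ss) (List.map-∘ Ss) ⟨
  sumℚ (List.map (λ s → A (suc (trues s)) * B (falses s)) Ss)
    + sumℚ (List.map (λ s → A (trues s) * B (suc (falses s))) Ss)
    ≡⟨ cong₂ _+_ (shuffle-sum n (A ∘ suc) B (deriv a) b (shift A a A≡) B≡)
                 (shuffle-sum n A (B ∘ suc) a (deriv b) A≡ (shift B b B≡)) ⟩
  fromℕ (n !) * (deriv a ⊛ b) n + fromℕ (n !) * (a ⊛ deriv b) n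
    ≡⟨ *-distribˡ-+ (fromℕ (n !)) _ _ ⟨
  fromℕ (n !) * ((deriv a ⊛ b) n + (a ⊛ deriv b) n)
    ≡⟨ cong (fromℕ (n !) *_) (deriv-⊛ a b n) ⟨
  fromℕ (n !) * (fromℕ (suc n) * (a ⊛ b) (suc n))
    ≡⟨ *-assoc (fromℕ (n !)) _ _ ⟨
  fromℕ (n !) * fromℕ (suc n) * (a ⊛ b) (suc n)
    ≡⟨ cong (_* (a ⊛ b) (suc n)) (trans (*-comm (fromℕ (n !)) _) (sym (fromℕ-! n))) ⟩
  fromℕ (suc n !) * (a ⊛ b) (suc n) ∎
  where
  Ss = allBoolVecs n
  w : Vec Bool (suc n) → ℚ
  w s = A (trues s) * B (falses s)
  shift : ∀ (C : ℕ → ℚ) (c : FPS) → (∀ k → C k ≡ fromℕ (k !) * c k) →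
          ∀ k → C (suc k) ≡ fromℕ (k !) * deriv c k
  shift C c C≡ k = begin
    C (suc k)                                ≡⟨ C≡ (suc k) ⟩
    fromℕ (suc k !) * c (suc k)              ≡⟨ cong (_* c (suc k)) (fromℕ-! k) ⟩
    fromℕ (suc k) * fromℕ (k !) * c (suc k)  ≡⟨ solve 3 (λ x y z → (x :* y) :* z := y :* (x :* z))
                                                  refl (fromℕ (suc k)) (fromℕ (k !)) (c (suc k)) ⟩
    fromℕ (k !) * deriv c k                  ∎

-- Total weights of finite sets

-- IsTotalWeight φ m x unfolds to TotalWeight (Valid {m}) (weight φ ∘ proj₁) x.
TotalWeight : {A : Set} → (A → Set) → (A → ℚ) → ℚ → Set
TotalWeight {A} P w x = Σ (List A) λ L → All P L × Unique L × (∀ a → P a → a ∈ L) × x ≡ sumℚ (List.map w L)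

sumℚ-↭ : ∀ {xs ys} → xs ↭ ys → sumℚ xs ≡ sumℚ ys
sumℚ-↭ p = ↭ₛ.foldr-commMonoid (setoid ℚ) +-0-isCommutativeMonoid (↭⇒↭ₛ p)

module _ {A : Set} {P : A → Set} {w : A → ℚ} where

  totalWeight-unique : ∀ {x y} → TotalWeight P w x → TotalWeight P w y → x ≡ y
  totalWeight-unique (L₁ , P-L₁ , uniq₁ , all₁ , x≡) (L₂ , P-L₂ , uniq₂ , all₂ , y≡) =
    trans x≡ (trans (sumℚ-↭ (↭.map⁺ w L₁↭L₂)) (sym y≡))
    where
    L₁↭L₂ : L₁ ↭ L₂
    L₁↭L₂ = ∼bag⇒↭ (unique∧set⇒bag uniq₁ uniq₂
      (mk⇔ (λ a∈L₁ → all₂ _ (All.lookup P-L₁ a∈L₁)) (λ a∈L₂ → all₁ _ (All.lookup P-L₂ a∈L₂))))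

  totalWeight-∅ : (∀ a → ¬ P a) → TotalWeight P w 0ℚ
  totalWeight-∅ ¬P = [] , [] , [] , (λ a Pa → ⊥-elim (¬P a Pa)) , refl

  totalWeight-singleton : ∀ a₀ → P a₀ → (∀ a → P a → a ≡ a₀) → TotalWeight P w (w a₀)
  totalWeight-singleton a₀ Pa₀ only-a₀ =
    a₀ ∷ [] , Pa₀ ∷ [] , [] ∷ [] , (λ a Pa → here (only-a₀ a Pa)) , sym (+-identityʳ (w a₀))

  totalWeight-scale : ∀ {x} c → TotalWeight P w x → TotalWeight P (λ a → c * w a) (c * x)
  totalWeight-scale c (L , P-L , uniq , all , x≡) = L , P-L , uniq , all , trans (cong (c *_) x≡) (*-distribˡ-sumℚ c w L)

  totalWeight-resp-≗ : ∀ {w′ x} → (∀ a → P a → w a ≡ w′ a) → TotalWeight P w x → TotalWeight P w′ x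
  totalWeight-resp-≗ {w′} w≡w′ (L , P-L , uniq , all , x≡) = L , P-L , uniq , all , trans x≡ (map-cong L P-L)
    where
    map-cong : ∀ L → All P L → sumℚ (List.map w L) ≡ sumℚ (List.map w′ L)
    map-cong []      []         = refl
    map-cong (a ∷ L) (Pa ∷ P-L) = cong₂ _+_ (w≡w′ a Pa) (map-cong L P-L)

  totalWeight-resp-⇔ : ∀ {Q : A → Set} {x} → (∀ a → P a → Q a) → (∀ a → Q a → P a) →
                       TotalWeight P w x → TotalWeight Q w x
  totalWeight-resp-⇔ P⇒Q Q⇒P (L , P-L , uniq , all , x≡) =
    L , All.map (P⇒Q _) P-L , uniq , (λ a Qa → all a (Q⇒P a Qa)) , x≡

  totalWeight-⊎ : ∀ {P₁ P₂ : A → Set} {x₁ x₂} →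
                  (∀ a → P a → P₁ a ⊎ P₂ a) → (∀ a → P₁ a → P a) → (∀ a → P₂ a → P a) → (∀ a → P₁ a → ¬ P₂ a) →
                  TotalWeight P₁ w x₁ → TotalWeight P₂ w x₂ → TotalWeight P w (x₁ + x₂)
  totalWeight-⊎ split P₁⇒P P₂⇒P disjoint
                (L₁ , P-L₁ , uniq₁ , all₁ , x₁≡) (L₂ , P-L₂ , uniq₂ , all₂ , x₂≡) =
    L₁ ++ L₂ ,
    All.++⁺ (All.map (P₁⇒P _) P-L₁) (All.map (P₂⇒P _) P-L₂) ,
    Unique.++⁺ uniq₁ uniq₂ (λ (a∈L₁ , a∈L₂) → disjoint _ (All.lookup P-L₁ a∈L₁) (All.lookup P-L₂ a∈L₂)) ,
    all ,
    trans (cong₂ _+_ x₁≡ x₂≡) (trans (sym (sumℚ-++ (List.map w L₁) _)) (cong sumℚ (sym (List.map-++ w L₁ L₂))))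
    where
    all : ∀ a → P a → a ∈ L₁ ++ L₂
    all a Pa with split a Pa
    ... | inj₁ P₁a = ∈.∈-++⁺ˡ (all₁ a P₁a)
    ... | inj₂ P₂a = ∈.∈-++⁺ʳ L₁ (all₂ a P₂a)

totalWeight-image : ∀ {A B : Set} {P : A → Set} {Q : B → Set} {v : B → ℚ} {x} (f : A → B) →
                    (∀ {a a′} → f a ≡ f a′ → a ≡ a′) →
                    (∀ a → P a → Q (f a)) → (∀ b → Q b → Σ A λ a → P a × f a ≡ b) →
                    TotalWeight P (v ∘ f) x → TotalWeight Q v x
totalWeight-image {v = v} f f-injective P⇒Q onto (L , P-L , uniq , all , x≡) =
  List.map f L , All.map⁺ (All.map (P⇒Q _) P-L) , Unique.map⁺ f-injective uniq , all-images ,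
  trans x≡ (cong sumℚ (List.map-∘ L))
  where
  all-images : ∀ b → _ → b ∈ List.map f L
  all-images b Qb with onto b Qb
  ... | a , Pa , refl = ∈.∈-map⁺ f (all a Pa)

totalWeight-Σ : ∀ {I : Set} {B : I → Set} {P : ∀ i → B i → Set} {w : ∀ i → B i → ℚ} {x : I → ℚ} →
                (is : List I) → Unique is → (∀ i → TotalWeight (P i) (w i) (x i)) →
                TotalWeight (λ (i , b) → i ∈ is × P i b) (λ (i , b) → w i b) (sumℚ (List.map x is))
totalWeight-Σ [] _ _ = totalWeight-∅ (λ _ ())
totalWeight-Σ {P = P} (i ∷ is) (i∉is ∷ uniq) total =
  totalWeight-⊎ split (λ { (_ , b) (refl , Pb) → here refl , Pb }) (λ _ (i∈is , Pb) → there i∈is , Pb)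
    (λ { (_ , b) (refl , _) (i∈is , _) → All.lookup i∉is i∈is refl })
    (totalWeight-image (i ,_) (λ { refl → refl }) (λ b Pb → refl , Pb) (λ { (_ , b) (refl , Pb) → b , Pb , refl })
      (total i))
    (totalWeight-Σ is uniq total)
  where
  split : ∀ ((j , b) : Σ _ _) → j ∈ i ∷ is × P j b → (j ≡ i × P j b) ⊎ (j ∈ is × P j b)
  split _ (here j≡i , Pb)   = inj₁ (j≡i , Pb)
  split _ (there j∈is , Pb) = inj₂ (j∈is , Pb)

totalWeight-× : ∀ {A B : Set} {P : A → Set} {Q : B → Set} {v : A → ℚ} {w : B → ℚ} {x y} →
                TotalWeight P v x → TotalWeight Q w y →
                TotalWeight (λ (a , b) → P a × Q b) (λ (a , b) → v a * w b) (x * y)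
totalWeight-× {v = v} {x = x} {y} (L , P-L , uniq , all , x≡) total-Q =
  subst (TotalWeight _ _) sum≡x*y
    (totalWeight-resp-⇔ (λ _ (a∈L , Qb) → All.lookup P-L a∈L , Qb) (λ (a , _) (Pa , Qb) → all a Pa , Qb)
      (totalWeight-Σ L uniq (λ a → totalWeight-scale (v a) total-Q)))
  where
  sum≡x*y : sumℚ (List.map (λ a → v a * y) L) ≡ x * y
  sum≡x*y = begin
    sumℚ (List.map (λ a → v a * y) L)   ≡⟨ cong sumℚ (List.map-cong (λ a → *-comm (v a) y) L) ⟩
    sumℚ (List.map (λ a → y * v a) L)   ≡⟨ *-distribˡ-sumℚ y v L ⟨
    y * sumℚ (List.map v L)             ≡⟨ cong (y *_) x≡ ⟨
    y * x                               ≡⟨ *-comm y x ⟩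
    x * y                               ∎

totalWeight-partition : ∀ {A : Set} {P : A → Set} {w : A → ℚ} {x : ℕ → ℚ} (g : A → ℕ) N →
                        (∀ a → P a → g a ℕ.≤ N) → (∀ j → j ℕ.≤ N → TotalWeight (λ a → P a × g a ≡ j) w (x j)) →
                        TotalWeight P w (sumUpTo N x)
totalWeight-partition g zero g≤0 total =
  totalWeight-resp-⇔ (λ _ → proj₁) (λ a Pa → Pa , ℕ.n≤0⇒n≡0 (g≤0 a Pa)) (total 0 z≤n)
totalWeight-partition {P = P} g (suc N) g≤1+N total =
  totalWeight-⊎ split (λ _ → proj₁) (λ _ → proj₁)
    (λ _ (_ , g≤N) (_ , g≡1+N) → ℕ.<-irrefl refl (subst (ℕ._≤ N) g≡1+N g≤N))
    (totalWeight-partition g N (λ _ → proj₂) total-≤N)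
    (total (suc N) ℕ.≤-refl)
  where
  split : ∀ a → P a → (P a × g a ℕ.≤ N) ⊎ (P a × g a ≡ suc N)
  split a Pa with ℕ.m≤n⇒m<n∨m≡n (g≤1+N a Pa)
  ... | inj₁ (s≤s g≤N) = inj₁ (Pa , g≤N)
  ... | inj₂ g≡1+N     = inj₂ (Pa , g≡1+N)
  total-≤N : ∀ j → j ℕ.≤ N → TotalWeight (λ a → (P a × g a ℕ.≤ N) × g a ≡ j) _ _
  total-≤N j j≤N = totalWeight-resp-⇔ (λ { _ (Pa , refl) → (Pa , j≤N) , refl }) (λ _ ((Pa , _) , g≡j) → Pa , g≡j)
    (total j (ℕ.m≤n⇒m≤1+n j≤N))

-- Multiplicities and parents-first orderings

OneOrTwo : ℕ → Set
OneOrTwo n = n ≡ 1 ⊎ n ≡ 2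

OneOrTwo⇒≢0 : ∀ {n} → OneOrTwo n → n ≢ 0
OneOrTwo⇒≢0 (inj₁ refl) ()
OneOrTwo⇒≢0 (inj₂ refl) ()

module Multiplicity {X : Set} (_≟_ : DecidableEquality X) where

  multiplicity : ∀ {m} → Vec X m → X → ℕ
  multiplicity v u = count (_≟ u) v

  -- Single ⊎ Double is OneOrTwoLabels of Defs, for an arbitrary type of nodes.
  Single : ∀ {m} → Vec X m → X → Set
  Single {m} v u = Σ (Fin m) λ i → lookup v i ≡ u × (∀ k → lookup v k ≡ u → k ≡ i)

  Double : ∀ {m} → Vec X m → X → Set
  Double {m} v u = Σ (Fin m) λ i → Σ (Fin m) λ j → i ≢ j × lookup v i ≡ u × lookup v j ≡ u
                   × (∀ k → lookup v k ≡ u → k ≡ i ⊎ k ≡ j)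

  multiplicity≡0⇒∉ : ∀ {m} (v : Vec X m) u → multiplicity v u ≡ 0 → ∀ k → lookup v k ≢ u
  multiplicity≡0⇒∉ (x ∷ v) u mult≡0 k with x ≟ u
  multiplicity≡0⇒∉ (x ∷ v) u ()     k       | yes _
  multiplicity≡0⇒∉ (x ∷ v) u mult≡0 zero    | no x≢u = x≢u
  multiplicity≡0⇒∉ (x ∷ v) u mult≡0 (suc k) | no _   = multiplicity≡0⇒∉ v u mult≡0 k

  ∉⇒multiplicity≡0 : ∀ {m} (v : Vec X m) u → (∀ k → lookup v k ≢ u) → multiplicity v u ≡ 0
  ∉⇒multiplicity≡0 []      u ∉v = refl
  ∉⇒multiplicity≡0 (x ∷ v) u ∉v with x ≟ u
  ... | yes x≡u = ⊥-elim (∉v zero x≡u)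
  ... | no _    = ∉⇒multiplicity≡0 v u (∉v ∘ suc)

  multiplicity≡1⇒single : ∀ {m} (v : Vec X m) u → multiplicity v u ≡ 1 → Single v u
  multiplicity≡1⇒single (x ∷ v) u mult≡1 with x ≟ u
  ... | yes x≡u = zero , x≡u , only-zero
    where
    only-zero : ∀ k → lookup (x ∷ v) k ≡ u → k ≡ zero
    only-zero zero    _     = refl
    only-zero (suc k) vₖ≡u = ⊥-elim (multiplicity≡0⇒∉ v u (ℕ.suc-injective mult≡1) k vₖ≡u)
  ... | no x≢u with multiplicity≡1⇒single v u mult≡1
  ...   | i , vᵢ≡u , only-i = suc i , vᵢ≡u , only-suc-i
    where
    only-suc-i : ∀ k → lookup (x ∷ v) k ≡ u → k ≡ suc i
    only-suc-i zero    x≡u  = ⊥-elim (x≢u x≡u)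
    only-suc-i (suc k) vₖ≡u = cong suc (only-i k vₖ≡u)

  single⇒multiplicity≡1 : ∀ {m} (v : Vec X m) u → Single v u → multiplicity v u ≡ 1
  single⇒multiplicity≡1 (x ∷ v) u (i , vᵢ≡u , only-i) with x ≟ u
  ... | yes x≡u =
    cong suc (∉⇒multiplicity≡0 v u (λ k vₖ≡u → Fin.0≢1+n (trans (only-i zero x≡u) (sym (only-i (suc k) vₖ≡u)))))
  single⇒multiplicity≡1 (x ∷ v) u (zero  , x≡u  , _)      | no x≢u = ⊥-elim (x≢u x≡u)
  single⇒multiplicity≡1 (x ∷ v) u (suc i , vᵢ≡u , only-i) | no _   =
    single⇒multiplicity≡1 v u (i , vᵢ≡u , λ k vₖ≡u → Fin.suc-injective (only-i (suc k) vₖ≡u))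

  multiplicity≡2⇒double : ∀ {m} (v : Vec X m) u → multiplicity v u ≡ 2 → Double v u
  multiplicity≡2⇒double (x ∷ v) u mult≡2 with x ≟ u
  ... | yes x≡u with multiplicity≡1⇒single v u (ℕ.suc-injective mult≡2)
  ...   | i , vᵢ≡u , only-i = zero , suc i , (λ ()) , x≡u , vᵢ≡u , zero-or-suc-i
    where
    zero-or-suc-i : ∀ k → lookup (x ∷ v) k ≡ u → k ≡ zero ⊎ k ≡ suc i
    zero-or-suc-i zero    _    = inj₁ refl
    zero-or-suc-i (suc k) vₖ≡u = inj₂ (cong suc (only-i k vₖ≡u))
  multiplicity≡2⇒double (x ∷ v) u mult≡2 | no x≢u with multiplicity≡2⇒double v u mult≡2
  ...   | i , j , i≢j , vᵢ≡u , vⱼ≡u , only-i-j =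
    suc i , suc j , i≢j ∘ Fin.suc-injective , vᵢ≡u , vⱼ≡u , suc-i-or-suc-j
    where
    suc-i-or-suc-j : ∀ k → lookup (x ∷ v) k ≡ u → k ≡ suc i ⊎ k ≡ suc j
    suc-i-or-suc-j zero    x≡u  = ⊥-elim (x≢u x≡u)
    suc-i-or-suc-j (suc k) vₖ≡u with only-i-j k vₖ≡u
    ... | inj₁ k≡i = inj₁ (cong suc k≡i)
    ... | inj₂ k≡j = inj₂ (cong suc k≡j)

  double⇒multiplicity≡2 : ∀ {m} (v : Vec X m) u → Double v u → multiplicity v u ≡ 2
  double⇒multiplicity≡2 (x ∷ v) u (i , j , i≢j , vᵢ≡u , vⱼ≡u , only-i-j) with x ≟ u
  double⇒multiplicity≡2 (x ∷ v) u (zero , zero , i≢j , _) | yes _ = ⊥-elim (i≢j refl)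
  double⇒multiplicity≡2 (x ∷ v) u (zero , suc j , _ , _ , vⱼ≡u , only-i-j) | yes _ =
    cong suc (single⇒multiplicity≡1 v u (j , vⱼ≡u , λ k vₖ≡u → drop-zero (only-i-j (suc k) vₖ≡u)))
    where
    drop-zero : ∀ {k} → suc k ≡ zero ⊎ suc k ≡ suc j → k ≡ j
    drop-zero (inj₁ ())
    drop-zero (inj₂ k≡j) = Fin.suc-injective k≡j
  double⇒multiplicity≡2 (x ∷ v) u (suc i , zero , _ , vᵢ≡u , _ , only-i-j) | yes _ =
    cong suc (single⇒multiplicity≡1 v u (i , vᵢ≡u , λ k vₖ≡u → drop-zero (only-i-j (suc k) vₖ≡u)))
    where
    drop-zero : ∀ {k} → suc k ≡ suc i ⊎ suc k ≡ zero → k ≡ i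
    drop-zero (inj₁ k≡i) = Fin.suc-injective k≡i
    drop-zero (inj₂ ())
  double⇒multiplicity≡2 (x ∷ v) u (suc i , suc j , _ , _ , _ , only-i-j) | yes x≡u with only-i-j zero x≡u
  ... | inj₁ ()
  ... | inj₂ ()
  double⇒multiplicity≡2 (x ∷ v) u (zero , _ , _ , x≡u , _) | no x≢u = ⊥-elim (x≢u x≡u)
  double⇒multiplicity≡2 (x ∷ v) u (suc i , zero , _ , _ , x≡u , _) | no x≢u = ⊥-elim (x≢u x≡u)
  double⇒multiplicity≡2 (x ∷ v) u (suc i , suc j , i≢j , vᵢ≡u , vⱼ≡u , only-i-j) | no _ =
    double⇒multiplicity≡2 v u
      (i , j , i≢j ∘ cong suc , vᵢ≡u , vⱼ≡u , λ k vₖ≡u → drop-suc (only-i-j (suc k) vₖ≡u))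
    where
    drop-suc : ∀ {k} → suc k ≡ suc i ⊎ suc k ≡ suc j → k ≡ i ⊎ k ≡ j
    drop-suc (inj₁ k≡i) = inj₁ (Fin.suc-injective k≡i)
    drop-suc (inj₂ k≡j) = inj₂ (Fin.suc-injective k≡j)

  single⊎double⇒oneOrTwo : ∀ {m} (v : Vec X m) u → Single v u ⊎ Double v u → OneOrTwo (multiplicity v u)
  single⊎double⇒oneOrTwo v u (inj₁ single) = inj₁ (single⇒multiplicity≡1 v u single)
  single⊎double⇒oneOrTwo v u (inj₂ double) = inj₂ (double⇒multiplicity≡2 v u double)

  oneOrTwo⇒single⊎double : ∀ {m} (v : Vec X m) u → OneOrTwo (multiplicity v u) → Single v u ⊎ Double v u
  oneOrTwo⇒single⊎double v u (inj₁ mult≡1) = inj₁ (multiplicity≡1⇒single v u mult≡1)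
  oneOrTwo⇒single⊎double v u (inj₂ mult≡2) = inj₂ (multiplicity≡2⇒double v u mult≡2)

module _ {X : Set} (R : X → X → Set) where

  IncreasingFor : ∀ {m} → Vec X m → Set
  IncreasingFor {m} v = ∀ (i j : Fin m) → R (lookup v i) (lookup v j) → i Fin.< j

  ParentsFirst : ∀ {m} → Vec X m → Set
  ParentsFirst []      = ⊤
  ParentsFirst (x ∷ v) = ¬ R x x × AllV (λ y → ¬ R y x) v × ParentsFirst v

  increasing⇒parentsFirst : ∀ {m} (v : Vec X m) → IncreasingFor v → ParentsFirst v
  increasing⇒parentsFirst []      _   = tt
  increasing⇒parentsFirst (x ∷ v) inc =
    (λ xRx → ℕ.<-irrefl refl (inc zero zero xRx)) ,
    Vecᴬ.lookup⁻ (λ i yRx → ℕ.n≮0 (inc (suc i) zero yRx)) ,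
    increasing⇒parentsFirst v (λ i j R-ij → ℕ.≤-pred (inc (suc i) (suc j) R-ij))

  parentsFirst⇒increasing : ∀ {m} (v : Vec X m) → ParentsFirst v → IncreasingFor v
  parentsFirst⇒increasing (x ∷ v) (¬xRx , _ , _)     zero    zero    xRx = ⊥-elim (¬xRx xRx)
  parentsFirst⇒increasing (x ∷ v) _                  zero    (suc j) _   = s≤s z≤n
  parentsFirst⇒increasing (x ∷ v) (_ , ¬yRx , _)     (suc i) zero    yRx = ⊥-elim (Vecᴬ.lookup⁺ ¬yRx i yRx)
  parentsFirst⇒increasing (x ∷ v) (_ , _ , pf)       (suc i) (suc j) R-ij = s≤s (parentsFirst⇒increasing v pf i j R-ij)

module _ {X Y : Set} {R : X → X → Set} (e : Y → X) where

  parentsFirst-map⁺ : ∀ {m} (w : Vec Y m) → ParentsFirst (λ a b → R (e a) (e b)) w → ParentsFirst R (Vec.map e w)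
  parentsFirst-map⁺ []      _                   = tt
  parentsFirst-map⁺ (y ∷ w) (¬yRy , ¬zRy , pf) = ¬yRy , Vecᴬ.map⁺ ¬zRy , parentsFirst-map⁺ w pf

  parentsFirst-map⁻ : ∀ {m} (w : Vec Y m) → ParentsFirst R (Vec.map e w) → ParentsFirst (λ a b → R (e a) (e b)) w
  parentsFirst-map⁻ []      _                   = tt
  parentsFirst-map⁻ (y ∷ w) (¬yRy , ¬zRy , pf) = ¬yRy , Vecᴬ.map⁻ ¬zRy , parentsFirst-map⁻ w pf

-- Labellings of trees and forests

below-injective : ∀ {ts} {p q : Any Pos ts} → below p ≡ below q → p ≡ q
below-injective refl = refl

here-injective : ∀ {t ts} {p q : Pos t} → here {P = Pos} {xs = ts} p ≡ here q → p ≡ q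
here-injective refl = refl

there-injective : ∀ {t ts} {p q : Any Pos ts} → there {P = Pos} {x = t} p ≡ there q → p ≡ q
there-injective refl = refl

mutual
  _≟ᵖ_ : ∀ {t} → DecidableEquality (Pos t)
  root    ≟ᵖ root    = yes refl
  root    ≟ᵖ below _ = no λ ()
  below _ ≟ᵖ root    = no λ ()
  below p ≟ᵖ below q = map′ (cong below) below-injective (p ≟ᶠ q)

  _≟ᶠ_ : ∀ {ts} → DecidableEquality (Any Pos ts)
  here p  ≟ᶠ here q  = map′ (cong here) here-injective (p ≟ᵖ q)
  here _  ≟ᶠ there _ = no λ ()
  there _ ≟ᶠ here _  = no λ ()
  there p ≟ᶠ there q = map′ (cong there) there-injective (p ≟ᶠ q)

module TreeMultiplicity {t : Tree} = Multiplicity (_≟ᵖ_ {t})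
module ForestMultiplicity {ts : List Tree} = Multiplicity (_≟ᶠ_ {ts})
open TreeMultiplicity using () renaming (multiplicity to multᵖ)
open ForestMultiplicity using () renaming (multiplicity to multᶠ)

-- Equivalent to IsUBLabelling, but decomposes along merge and along the root.
UBTree : ∀ {t m} → Vec (Pos t) m → Set
UBTree v = (∀ u → OneOrTwo (multᵖ v u)) × ParentsFirst Child v

UBForest : ∀ {ts m} → Vec (Any Pos ts) m → Set
UBForest w = (∀ u → OneOrTwo (multᶠ w u)) × ParentsFirst ChildAny w

isUBLabelling⇒UBTree : ∀ {t m} (v : Vec (Pos t) m) → IsUBLabelling v → UBTree v
isUBLabelling⇒UBTree v (oneOrTwo , increasing) =
  (λ u → TreeMultiplicity.single⊎double⇒oneOrTwo v u (oneOrTwo u)) , increasing⇒parentsFirst Child v increasing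

UBTree⇒isUBLabelling : ∀ {t m} (v : Vec (Pos t) m) → UBTree v → IsUBLabelling v
UBTree⇒isUBLabelling v (oneOrTwo , parentsFirst) =
  (λ u → TreeMultiplicity.oneOrTwo⇒single⊎double v u (oneOrTwo u)) , parentsFirst⇒increasing Child v parentsFirst

-- s sends each label to the first tree (true) or to the remaining forest (false).
merge : ∀ {t ts n} (s : Vec Bool n) → Vec (Pos t) (trues s) → Vec (Any Pos ts) (falses s) → Vec (Any Pos (t ∷ ts)) n
merge []          []       []       = []
merge (true ∷ s)  (x ∷ v₁) v₂       = here x ∷ merge s v₁ v₂
merge (false ∷ s) v₁       (y ∷ v₂) = there y ∷ merge s v₁ v₂

Unmerged : Tree → List Tree → ℕ → Set
Unmerged t ts n = Σ (Vec Bool n) λ s → Vec (Pos t) (trues s) × Vec (Any Pos ts) (falses s)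

unmerge : ∀ {t ts n} → Vec (Any Pos (t ∷ ts)) n → Unmerged t ts n
unmerge []            = [] , [] , []
unmerge (here x ∷ w)  = let s , v₁ , v₂ = unmerge w in true ∷ s , x ∷ v₁ , v₂
unmerge (there y ∷ w) = let s , v₁ , v₂ = unmerge w in false ∷ s , v₁ , y ∷ v₂

mergeᵘ : ∀ {t ts n} → Unmerged t ts n → Vec (Any Pos (t ∷ ts)) n
mergeᵘ (s , v₁ , v₂) = merge s v₁ v₂

merge-unmerge : ∀ {t ts n} (w : Vec (Any Pos (t ∷ ts)) n) → mergeᵘ (unmerge w) ≡ w
merge-unmerge []            = refl
merge-unmerge (here x ∷ w)  = cong (here x ∷_) (merge-unmerge w)
merge-unmerge (there y ∷ w) = cong (there y ∷_) (merge-unmerge w)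

unmerge-merge : ∀ {t ts n} (s : Vec Bool n) (v₁ : Vec (Pos t) (trues s)) (v₂ : Vec (Any Pos ts) (falses s)) →
                unmerge (merge s v₁ v₂) ≡ (s , v₁ , v₂)
unmerge-merge []          []       []       = refl
unmerge-merge (true ∷ s)  (x ∷ v₁) v₂       rewrite unmerge-merge s v₁ v₂ = refl
unmerge-merge (false ∷ s) v₁       (y ∷ v₂) rewrite unmerge-merge s v₁ v₂ = refl

module _ {t : Tree} {ts : List Tree} where

  multiplicity-merge-here : ∀ {n} (s : Vec Bool n) (v₁ : Vec (Pos t) (trues s)) (v₂ : Vec (Any Pos ts) (falses s)) p →
                            multᶠ (merge s v₁ v₂) (here p) ≡ multᵖ v₁ p
  multiplicity-merge-here []          []       []       p = refl
  multiplicity-merge-here (true ∷ s)  (x ∷ v₁) v₂       p with x ≟ᵖ p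
  ... | yes _ = cong suc (multiplicity-merge-here s v₁ v₂ p)
  ... | no _  = multiplicity-merge-here s v₁ v₂ p
  multiplicity-merge-here (false ∷ s) v₁       (y ∷ v₂) p = multiplicity-merge-here s v₁ v₂ p

  multiplicity-merge-there : ∀ {n} (s : Vec Bool n) (v₁ : Vec (Pos t) (trues s)) (v₂ : Vec (Any Pos ts) (falses s)) q →
                             multᶠ (merge s v₁ v₂) (there q) ≡ multᶠ v₂ q
  multiplicity-merge-there []          []       []       q = refl
  multiplicity-merge-there (true ∷ s)  (x ∷ v₁) v₂       q = multiplicity-merge-there s v₁ v₂ q
  multiplicity-merge-there (false ∷ s) v₁       (y ∷ v₂) q with y ≟ᶠ q
  ... | yes _ = cong suc (multiplicity-merge-there s v₁ v₂ q)
  ... | no _  = multiplicity-merge-there s v₁ v₂ q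

  All-merge⁺ : ∀ {n} {P : Any Pos (t ∷ ts) → Set} (s : Vec Bool n)
               {v₁ : Vec (Pos t) (trues s)} {v₂ : Vec (Any Pos ts) (falses s)} →
               AllV (P ∘ here) v₁ → AllV (P ∘ there) v₂ → AllV P (merge s v₁ v₂)
  All-merge⁺ []          []         []         = []
  All-merge⁺ (true ∷ s)  (px ∷ pv₁) pv₂        = px ∷ All-merge⁺ s pv₁ pv₂
  All-merge⁺ (false ∷ s) pv₁        (py ∷ pv₂) = py ∷ All-merge⁺ s pv₁ pv₂

  All-merge⁻ : ∀ {n} {P : Any Pos (t ∷ ts) → Set} (s : Vec Bool n)
               (v₁ : Vec (Pos t) (trues s)) (v₂ : Vec (Any Pos ts) (falses s)) →
               AllV P (merge s v₁ v₂) → AllV (P ∘ here) v₁ × AllV (P ∘ there) v₂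
  All-merge⁻ []          []       []       []        = [] , []
  All-merge⁻ (true ∷ s)  (x ∷ v₁) v₂       (px ∷ pw) = let pv₁ , pv₂ = All-merge⁻ s v₁ v₂ pw in px ∷ pv₁ , pv₂
  All-merge⁻ (false ∷ s) v₁       (y ∷ v₂) (py ∷ pw) = let pv₁ , pv₂ = All-merge⁻ s v₁ v₂ pw in pv₁ , py ∷ pv₂

  parentsFirst-merge⁺ : ∀ {n} (s : Vec Bool n) (v₁ : Vec (Pos t) (trues s)) (v₂ : Vec (Any Pos ts) (falses s)) →
                        ParentsFirst Child v₁ → ParentsFirst ChildAny v₂ → ParentsFirst ChildAny (merge s v₁ v₂)
  parentsFirst-merge⁺ []          []       []       _                   _ = tt
  parentsFirst-merge⁺ (true ∷ s)  (x ∷ v₁) v₂       (¬xRx , ¬vRx , pf₁) pf₂ =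
    ¬xRx , All-merge⁺ s ¬vRx (Vecᴬ.universal (λ _ ()) v₂) , parentsFirst-merge⁺ s v₁ v₂ pf₁ pf₂
  parentsFirst-merge⁺ (false ∷ s) v₁       (y ∷ v₂) pf₁ (¬yRy , ¬vRy , pf₂) =
    ¬yRy , All-merge⁺ s (Vecᴬ.universal (λ _ ()) v₁) ¬vRy , parentsFirst-merge⁺ s v₁ v₂ pf₁ pf₂

  parentsFirst-merge⁻ : ∀ {n} (s : Vec Bool n) (v₁ : Vec (Pos t) (trues s)) (v₂ : Vec (Any Pos ts) (falses s)) →
                        ParentsFirst ChildAny (merge s v₁ v₂) → ParentsFirst Child v₁ × ParentsFirst ChildAny v₂
  parentsFirst-merge⁻ []          []       []       _ = tt , tt
  parentsFirst-merge⁻ (true ∷ s)  (x ∷ v₁) v₂       (¬xRx , ¬wRx , pf) =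
    let pf₁ , pf₂ = parentsFirst-merge⁻ s v₁ v₂ pf in (¬xRx , proj₁ (All-merge⁻ s v₁ v₂ ¬wRx) , pf₁) , pf₂
  parentsFirst-merge⁻ (false ∷ s) v₁       (y ∷ v₂) (¬yRy , ¬wRy , pf) =
    let pf₁ , pf₂ = parentsFirst-merge⁻ s v₁ v₂ pf in pf₁ , (¬yRy , proj₂ (All-merge⁻ s v₁ v₂ ¬wRy) , pf₂)

  UBForest-merge⁺ : ∀ {n} (s : Vec Bool n) (v₁ : Vec (Pos t) (trues s)) (v₂ : Vec (Any Pos ts) (falses s)) →
                    UBTree v₁ → UBForest v₂ → UBForest (merge s v₁ v₂)
  UBForest-merge⁺ s v₁ v₂ (oneOrTwo₁ , pf₁) (oneOrTwo₂ , pf₂) = oneOrTwo , parentsFirst-merge⁺ s v₁ v₂ pf₁ pf₂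
    where
    oneOrTwo : ∀ u → OneOrTwo (multᶠ (merge s v₁ v₂) u)
    oneOrTwo (here p)  = subst OneOrTwo (sym (multiplicity-merge-here s v₁ v₂ p)) (oneOrTwo₁ p)
    oneOrTwo (there q) = subst OneOrTwo (sym (multiplicity-merge-there s v₁ v₂ q)) (oneOrTwo₂ q)

  UBForest-merge⁻ : ∀ {n} (s : Vec Bool n) (v₁ : Vec (Pos t) (trues s)) (v₂ : Vec (Any Pos ts) (falses s)) →
                    UBForest (merge s v₁ v₂) → UBTree v₁ × UBForest v₂
  UBForest-merge⁻ s v₁ v₂ (oneOrTwo , pf) =
    let pf₁ , pf₂ = parentsFirst-merge⁻ s v₁ v₂ pf in
    ((λ p → subst OneOrTwo (multiplicity-merge-here s v₁ v₂ p) (oneOrTwo (here p))) , pf₁) ,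
    ((λ q → subst OneOrTwo (multiplicity-merge-there s v₁ v₂ q) (oneOrTwo (there q))) , pf₂)

UBTree-nonempty : ∀ {t} (v : Vec (Pos t) 0) → ¬ UBTree v
UBTree-nonempty {node _} [] (oneOrTwo , _) with oneOrTwo root
... | inj₁ ()
... | inj₂ ()

UBForest-length : ∀ {ts n} (w : Vec (Any Pos ts) n) → UBForest w → length ts ℕ.≤ n
UBForest-length {[]}     w _   = z≤n
UBForest-length {t ∷ ts} w ub with unmerge w | merge-unmerge w
... | s , v₁ , v₂ | refl with UBForest-merge⁻ s v₁ v₂ ub
...   | ub₁ , ub₂ = subst (suc (length ts) ℕ.≤_) (trues+falses s)
                      (ℕ.+-mono-≤ (nonempty v₁ ub₁) (UBForest-length v₂ ub₂))
  where
  nonempty : ∀ {k} (v : Vec (Pos t) k) → UBTree v → 1 ℕ.≤ k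
  nonempty {zero}  v ub = ⊥-elim (UBTree-nonempty v ub)
  nonempty {suc k} v ub = s≤s z≤n

oneRootLabel : ∀ {ts m} → Vec (Any Pos ts) m → Vec (Pos (node ts)) (suc m)
oneRootLabel w = root ∷ Vec.map below w

twoRootLabels : ∀ {ts m} → Vec (Any Pos ts) m → Vec (Pos (node ts)) (suc (suc m))
twoRootLabels w = root ∷ root ∷ Vec.map below w

map-below-injective : ∀ {ts m} {w w′ : Vec (Any Pos ts) m} → Vec.map below w ≡ Vec.map below w′ → w ≡ w′
map-below-injective {w = []}    {[]}     _  = refl
map-below-injective {w = y ∷ w} {y′ ∷ w′} eq =
  cong₂ _∷_ (below-injective (Vec.∷-injectiveˡ eq)) (map-below-injective (Vec.∷-injectiveʳ eq))

oneRootLabel-injective : ∀ {ts m} {w w′ : Vec (Any Pos ts) m} → oneRootLabel w ≡ oneRootLabel w′ → w ≡ w′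
oneRootLabel-injective = map-below-injective ∘ Vec.∷-injectiveʳ

twoRootLabels-injective : ∀ {ts m} {w w′ : Vec (Any Pos ts) m} → twoRootLabels w ≡ twoRootLabels w′ → w ≡ w′
twoRootLabels-injective = map-below-injective ∘ Vec.∷-injectiveʳ ∘ Vec.∷-injectiveʳ

module _ {ts : List Tree} where

  multiplicity-map-below-root : ∀ {m} (w : Vec (Any Pos ts) m) → multᵖ (Vec.map below w) root ≡ 0
  multiplicity-map-below-root []      = refl
  multiplicity-map-below-root (y ∷ w) = multiplicity-map-below-root w

  multiplicity-map-below : ∀ {m} (w : Vec (Any Pos ts) m) q → multᵖ (Vec.map below w) (below q) ≡ multᶠ w q
  multiplicity-map-below []      q = refl
  multiplicity-map-below (y ∷ w) q with y ≟ᶠ q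
  ... | yes _ = cong suc (multiplicity-map-below w q)
  ... | no _  = multiplicity-map-below w q

  map-below-parentsFirst : ∀ {m} (w : Vec (Any Pos ts) m) → UBForest w →
                 ParentsFirst Child (Vec.map below w) × AllV (λ y → ¬ Child y root) (Vec.map below w)
  map-below-parentsFirst w (_ , pf) = parentsFirst-map⁺ below w pf , Vecᴬ.universal not-parent-of-root (Vec.map below w)
    where
    not-parent-of-root : ∀ y → ¬ Child y root
    not-parent-of-root root      ()
    not-parent-of-root (below _) ()

  UBTree-oneRootLabel⁺ : ∀ {m} (w : Vec (Any Pos ts) m) → UBForest w → UBTree (oneRootLabel w)
  UBTree-oneRootLabel⁺ w ub@(oneOrTwo , _) = oneOrTwo′ , (λ ()) , proj₂ (map-below-parentsFirst w ub) , proj₁ (map-below-parentsFirst w ub)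
    where
    oneOrTwo′ : ∀ u → OneOrTwo (multᵖ (oneRootLabel w) u)
    oneOrTwo′ root      = inj₁ (cong suc (multiplicity-map-below-root w))
    oneOrTwo′ (below q) = subst OneOrTwo (sym (multiplicity-map-below w q)) (oneOrTwo q)

  UBTree-twoRootLabels⁺ : ∀ {m} (w : Vec (Any Pos ts) m) → UBForest w → UBTree (twoRootLabels w)
  UBTree-twoRootLabels⁺ w ub@(oneOrTwo , _) =
    oneOrTwo′ , (λ ()) , ((λ ()) ∷ proj₂ (map-below-parentsFirst w ub)) ,
    (λ ()) , proj₂ (map-below-parentsFirst w ub) , proj₁ (map-below-parentsFirst w ub)
    where
    oneOrTwo′ : ∀ u → OneOrTwo (multᵖ (twoRootLabels w) u)
    oneOrTwo′ root      = inj₂ (cong (λ k → suc (suc k)) (multiplicity-map-below-root w))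
    oneOrTwo′ (below q) = subst OneOrTwo (sym (multiplicity-map-below w q)) (oneOrTwo q)

  UBForest-below : ∀ {m} (w : Vec (Any Pos ts) m) → (∀ q → OneOrTwo (multᵖ (Vec.map below w) (below q))) →
                   ParentsFirst Child (Vec.map below w) → UBForest w
  UBForest-below w oneOrTwo pf =
    (λ q → subst OneOrTwo (multiplicity-map-below w q) (oneOrTwo q)) , parentsFirst-map⁻ below w pf

  UBTree-oneRootLabel⁻ : ∀ {m} (w : Vec (Any Pos ts) m) → UBTree (oneRootLabel w) → UBForest w
  UBTree-oneRootLabel⁻ w (oneOrTwo , _ , _ , pf) = UBForest-below w (oneOrTwo ∘ below) pf

  UBTree-twoRootLabels⁻ : ∀ {m} (w : Vec (Any Pos ts) m) → UBTree (twoRootLabels w) → UBForest w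
  UBTree-twoRootLabels⁻ w (oneOrTwo , _ , _ , _ , _ , pf) = UBForest-below w (oneOrTwo ∘ below) pf

parent : ∀ {ts} (q : Any Pos ts) → Σ (Pos (node ts)) λ p → Child p (below q)
parent (here root)      = root , tt
parent (here (below r)) = let p , p◁r = parent r in below (here p) , p◁r
parent (there q) with parent q
... | root    , p◁q = root , p◁q
... | below p , p◁q = below (there p) , p◁q

parent-unlabelled : ∀ {t m} p x (v : Vec (Pos t) m) → ParentsFirst Child (x ∷ v) → Child p x → multᵖ (x ∷ v) p ≡ 0
parent-unlabelled p x v (¬x◁x , ¬v◁x , _) p◁x = TreeMultiplicity.∉⇒multiplicity≡0 (x ∷ v) p not-labelled
  where
  not-labelled : ∀ k → lookup (x ∷ v) k ≢ p
  not-labelled zero    refl = ¬x◁x p◁x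
  not-labelled (suc k) vₖ≡p = Vecᴬ.lookup⁺ ¬v◁x k (subst (λ y → Child y x) (sym vₖ≡p) p◁x)

module _ {ts : List Tree} where

  first-label-at-root : ∀ {m} x (v : Vec (Pos (node ts)) m) → UBTree (x ∷ v) → x ≡ root
  first-label-at-root root      v _               = refl
  first-label-at-root (below q) v (oneOrTwo , pf) =
    let p , p◁x = parent q in ⊥-elim (OneOrTwo⇒≢0 (oneOrTwo p) (parent-unlabelled p (below q) v pf p◁x))

  second-root-label-next : ∀ {m} x (v : Vec (Pos (node ts)) m) →
                           UBTree (root ∷ x ∷ v) → multᵖ (x ∷ v) root ≡ 1 → x ≡ root
  second-root-label-next root      v _                       _ = refl
  second-root-label-next (below q) v (oneOrTwo , _ , _ , pf) mult≡1 with parent q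
  ... | root    , p◁x = ⊥-elim (ℕ.0≢1+n (trans (sym (parent-unlabelled root (below q) v pf p◁x)) mult≡1))
  ... | below p , p◁x = ⊥-elim (OneOrTwo⇒≢0 (oneOrTwo (below p)) (parent-unlabelled (below p) (below q) v pf p◁x))

  labels-below : ∀ {m} (v : Vec (Pos (node ts)) m) → multᵖ v root ≡ 0 →
                 Σ (Vec (Any Pos ts) m) λ w → v ≡ Vec.map below w
  labels-below []            _      = [] , refl
  labels-below (below q ∷ v) mult≡0 = let w , v≡ = labels-below v mult≡0 in q ∷ w , cong (below q ∷_) v≡

data RootLabels {ts : List Tree} : ∀ {m} → Vec (Pos (node ts)) m → Set where
  single : ∀ {m} (w : Vec (Any Pos ts) m) → RootLabels (oneRootLabel w)
  double : ∀ {m} (w : Vec (Any Pos ts) m) → RootLabels (twoRootLabels w)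

rootLabels : ∀ {ts m} (v : Vec (Pos (node ts)) m) → UBTree v → RootLabels v
rootLabels []      ub = ⊥-elim (UBTree-nonempty [] ub)
rootLabels (x ∷ v) ub with first-label-at-root x v ub
... | refl with proj₁ ub root
...   | inj₁ mult≡1 with labels-below v (ℕ.suc-injective mult≡1)
...     | w , refl = single w
rootLabels (x ∷ []) ub      | refl | inj₂ ()
rootLabels (x ∷ y ∷ v) ub   | refl | inj₂ mult≡2 with second-root-label-next y v ub (ℕ.suc-injective mult≡2)
...     | refl with labels-below v (ℕ.suc-injective (ℕ.suc-injective mult≡2))
...       | w , refl = double w

-- Counting labelled trees

LForest : ℕ → Set
LForest n = Σ (List Tree) λ ts → Vec (Any Pos ts) n

module _ (φ : ℕ → ℚ) (T : ℕ → ℚ) (T-total : ∀ m → IsTotalWeight φ (suc m) (T (suc m))) where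

  treeWeight : ∀ {m} → LTree m → ℚ
  treeWeight (t , _) = weight φ t

  forestWeight : ∀ {n} → LForest n → ℚ
  forestWeight (ts , _) = weightForest φ ts

  tree-total : ∀ k → TotalWeight (Valid {k}) treeWeight (fromℕ (k !) * egf T k)
  tree-total zero    = subst (TotalWeight Valid treeWeight) (sym (*-zeroʳ 1ℚ))
                         (totalWeight-∅ (λ (_ , v) valid → UBTree-nonempty v (isUBLabelling⇒UBTree v valid)))
  tree-total (suc k) = subst (TotalWeight Valid treeWeight) T≡ (T-total k)
    where
    T≡ : T (suc k) ≡ fromℕ (suc k !) * egf T (suc k)
    T≡ = begin
      T (suc k)                                         ≡⟨ *-identityʳ (T (suc k)) ⟨
      T (suc k) * 1ℚ                                    ≡⟨ cong (T (suc k) *_) (invFact-inverse (suc k)) ⟨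
      T (suc k) * (invFact (suc k) * fromℕ (suc k !))   ≡⟨ solve 3 (λ t i f → t :* (i :* f) := f :* (t :* i))
                                                             refl (T (suc k)) (invFact (suc k)) (fromℕ (suc k !)) ⟩
      fromℕ (suc k !) * egf T (suc k)                   ∎

  UBForestWith : ℕ → ∀ {n} → LForest n → Set
  UBForestWith j (ts , w) = UBForest w × length ts ≡ j

  Split : ℕ → Set
  Split n = Σ (Vec Bool n) λ s → LTree (trues s) × LForest (falses s)

  ValidSplit : ℕ → ∀ {n} → Split n → Set
  ValidSplit j (_ , tree , forest) = Valid tree × UBForestWith j forest

  graft : ∀ {n} → Split n → LForest n
  graft (s , (t , v₁) , (ts , v₂)) = t ∷ ts , merge s v₁ v₂

  graft-injective : ∀ {n} {a a′ : Split n} → graft a ≡ graft a′ → a ≡ a′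
  graft-injective {a = s , (_ , v₁) , (_ , v₂)} {s′ , (_ , v₁′) , (_ , v₂′)} eq with cong proj₁ eq
  ... | refl with trans (sym (unmerge-merge s v₁ v₂))
                   (trans (cong unmerge (,-injectiveʳ eq)) (unmerge-merge s′ v₁′ v₂′))
  ...   | refl = refl

  forest-total : ∀ j n → TotalWeight (UBForestWith j {n}) forestWeight (fromℕ (n !) * pow (egf T) j n)
  forest-total zero zero = subst (TotalWeight (UBForestWith 0) forestWeight) (sym (*-identityˡ 1ℚ))
    (totalWeight-singleton ([] , []) (((λ ()) , tt) , refl) only-empty)
    where
    only-empty : ∀ (a : LForest 0) → UBForestWith 0 a → a ≡ ([] , [])
    only-empty ([] , []) _ = refl
  forest-total zero (suc n) = subst (TotalWeight (UBForestWith 0) forestWeight) (sym (*-zeroʳ (fromℕ (suc n !))))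
    (totalWeight-∅ λ { ([] , () ∷ _) _ ; (_ ∷ _ , _) (_ , ()) })
  forest-total (suc j) n =
    subst (TotalWeight (UBForestWith (suc j)) forestWeight)
      (shuffle-sum n (λ k → fromℕ (k !) * egf T k) (λ k → fromℕ (k !) * pow (egf T) j k) (egf T) (pow (egf T) j)
        (λ _ → refl) (λ _ → refl))
      (totalWeight-image graft graft-injective grafted ungraft
        (totalWeight-resp-⇔ (λ _ → proj₂) (λ (s , _) valid → ∈-allBoolVecs s , valid)
          (totalWeight-Σ (allBoolVecs n) (allBoolVecs-unique n)
            (λ s → totalWeight-× (tree-total (trues s)) (forest-total j (falses s))))))
    where
    grafted : ∀ a → ValidSplit j a → UBForestWith (suc j) (graft a)
    grafted (s , (_ , v₁) , (_ , v₂)) (valid , ub , len≡j) =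
      UBForest-merge⁺ s v₁ v₂ (isUBLabelling⇒UBTree v₁ valid) ub , cong suc len≡j
    ungraft : ∀ b → UBForestWith (suc j) b → Σ (Split n) λ a → ValidSplit j a × graft a ≡ b
    ungraft (t ∷ ts , w) (ub , len≡) with unmerge w | merge-unmerge w
    ... | s , v₁ , v₂ | refl with UBForest-merge⁻ s v₁ v₂ ub
    ...   | ub₁ , ub₂ =
      (s , (t , v₁) , (ts , v₂)) , (UBTree⇒isUBLabelling v₁ ub₁ , ub₂ , ℕ.suc-injective len≡) , refl

  φ∘T : FPS
  φ∘T = compose φ (egf T)

  rootWeight : ∀ {n} → LForest n → ℚ
  rootWeight (ts , _) = φ (length ts) * weightForest φ ts

  rooted-forest-total : ∀ n → TotalWeight (λ ((_ , w) : LForest n) → UBForest w) rootWeight (fromℕ (n !) * φ∘T n)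
  rooted-forest-total n =
    subst (TotalWeight _ rootWeight) sum≡
      (totalWeight-partition (length ∘ proj₁) n (λ (_ , w) → UBForest-length w)
        (λ j _ → totalWeight-resp-≗ (λ (ts , _) (_ , len≡j) → cong (λ k → φ k * weightForest φ ts) (sym len≡j))
          (totalWeight-scale (φ j) (forest-total j n))))
    where
    sum≡ : sumUpTo n (λ j → φ j * (fromℕ (n !) * pow (egf T) j n)) ≡ fromℕ (n !) * φ∘T n
    sum≡ = trans (sumUpTo-cong n (λ j _ → solve 3 (λ a f p → a :* (f :* p) := f :* (a :* p))
                                             refl (φ j) (fromℕ (n !)) (pow (egf T) j n)))
             (sym (*-distribˡ-sumUpTo n (fromℕ (n !)) (λ j → φ j * pow (egf T) j n)))

  RootLabelling : ℕ → ℕ → Set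
  RootLabelling m k = ∀ {ts} → Vec (Any Pos ts) m → Vec (Pos (node ts)) k

  plant : ∀ {m k} → RootLabelling m k → LForest m → LTree k
  plant labels (ts , w) = node ts , labels w

  Planted : ∀ {m k} → RootLabelling m k → LTree k → Set
  Planted {m} labels p = Valid p × Σ (LForest m) λ a → plant labels a ≡ p

  planted-total : ∀ {m k} (labels : RootLabelling m k) →
                  (∀ {ts} {w w′ : Vec (Any Pos ts) m} → labels w ≡ labels w′ → w ≡ w′) →
                  (∀ {ts} (w : Vec (Any Pos ts) m) → UBForest w → UBTree (labels w)) →
                  (∀ {ts} (w : Vec (Any Pos ts) m) → UBTree (labels w) → UBForest w) →
                  TotalWeight (Planted labels) treeWeight (fromℕ (m !) * φ∘T m)
  planted-total {m} labels labels-injective ub⁺ ub⁻ =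
    totalWeight-image (plant labels) plant-injective
      (λ a@(_ , w) ub → UBTree⇒isUBLabelling (labels w) (ub⁺ w ub) , a , refl)
      (λ { _ (valid , a@(_ , w) , refl) → a , ub⁻ w (isUBLabelling⇒UBTree (labels w) valid) , refl })
      (rooted-forest-total m)
    where
    plant-injective : ∀ {a a′ : LForest m} → plant labels a ≡ plant labels a′ → a ≡ a′
    plant-injective {ts , _} eq with cong proj₁ eq
    ... | refl = cong (ts ,_) (labels-injective (,-injectiveʳ eq))

  one-root-label-total : ∀ m → TotalWeight (Planted {m} oneRootLabel) treeWeight (fromℕ (m !) * φ∘T m)
  one-root-label-total m =
    planted-total oneRootLabel oneRootLabel-injective UBTree-oneRootLabel⁺ UBTree-oneRootLabel⁻

  two-root-labels-total : ∀ m → TotalWeight (Planted {m} twoRootLabels) treeWeight (fromℕ (m !) * φ∘T m)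
  two-root-labels-total m =
    planted-total twoRootLabels twoRootLabels-injective UBTree-twoRootLabels⁺ UBTree-twoRootLabels⁻

  T-one-label : T 1 ≡ fromℕ (0 !) * φ∘T 0
  T-one-label = totalWeight-unique (T-total 0) (totalWeight-resp-⇔ (λ _ → proj₁) planted (one-root-label-total 0))
    where
    planted : ∀ p → Valid p → Planted {0} oneRootLabel p
    planted (node ts , v) valid with rootLabels v (isUBLabelling⇒UBTree v valid)
    ... | single w = valid , (ts , w) , refl

  T-recurrence : ∀ m → T (suc (suc m)) ≡ fromℕ (suc m !) * φ∘T (suc m) + fromℕ (m !) * φ∘T m
  T-recurrence m = totalWeight-unique (T-total (suc m))
    (totalWeight-⊎ planted (λ _ → proj₁) (λ _ → proj₁) disjoint
      (one-root-label-total (suc m)) (two-root-labels-total m))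
    where
    planted : ∀ p → Valid p → Planted {suc m} oneRootLabel p ⊎ Planted {m} twoRootLabels p
    planted (node ts , v) valid with rootLabels v (isUBLabelling⇒UBTree v valid)
    ... | single w = inj₁ (valid , (ts , w) , refl)
    ... | double w = inj₂ (valid , (ts , w) , refl)
    disjoint : ∀ p → Planted {suc m} oneRootLabel p → ¬ Planted {m} twoRootLabels p
    disjoint _ (_ , (_ , _ ∷ _) , refl) (_ , _ , ())

  T″-coefficient : ∀ n → deriv (deriv (egf T)) n ≡ φ∘T n + deriv φ∘T n
  T″-coefficient n = begin
    deriv (deriv (egf T)) n                                  ≡⟨ deriv-deriv-egf T n ⟩
    T (suc (suc n)) * invFact n                              ≡⟨ cong (_* i) (T-recurrence n) ⟩
    (fromℕ (suc n !) * c₁ + f * c₀) * i                      ≡⟨ cong (λ x → (x * c₁ + f * c₀) * i) (fromℕ-! n) ⟩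
    (a * f * c₁ + f * c₀) * i                                ≡⟨ solve 5 (λ a f c₁ c₀ i → (a :* f :* c₁ :+ f :* c₀) :* i
                                                                           := (c₀ :+ a :* c₁) :* (i :* f))
                                                                  refl a f c₁ c₀ i ⟩
    (c₀ + deriv φ∘T n) * (i * f)                             ≡⟨ cong ((c₀ + deriv φ∘T n) *_) (invFact-inverse n) ⟩
    (c₀ + deriv φ∘T n) * 1ℚ                                  ≡⟨ *-identityʳ (c₀ + deriv φ∘T n) ⟩
    φ∘T n + deriv φ∘T n                                      ∎
    where
    a = fromℕ (suc n)
    f = fromℕ (n !)
    i = invFact n
    c₀ = φ∘T n
    c₁ = φ∘T (suc n)

  T′-at-0 : deriv (egf T) 0 ≡ φ 0
  T′-at-0 = begin
    fromℕ 1 * (T 1 * invFact 1)                 ≡⟨ cong (λ x → fromℕ 1 * (x * invFact 1)) T-one-label ⟩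
    fromℕ 1 * ((1ℚ * (φ 0 * 1ℚ)) * invFact 1)   ≡⟨ solve 1 (λ x → con 1ℚ :* ((con 1ℚ :* (x :* con 1ℚ)) :* con 1ℚ) := x)
                                                     refl (φ 0) ⟩
    φ 0                                         ∎

proposition8p1 : (φ : ℕ → ℚ) → (∀ j → 0ℚ ≤ φ j) → 0ℚ < φ 0
    → (T : ℕ → ℚ) → (∀ m → IsTotalWeight φ (suc m) (T (suc m)))
    → (∀ n → deriv (deriv (egf T)) n
               ≡ compose φ (egf T) n + (deriv (egf T) ⊛ compose (deriv φ) (egf T)) n)
      × egf T 0 ≡ 0ℚ
      × deriv (egf T) 0 ≡ φ 0
proposition8p1 φ _ _ T T-total =
  (λ n → trans (T″-coefficient φ T T-total n) (cong (φ∘T φ T T-total n +_) (deriv-compose φ (egf T) refl n))) ,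
  refl ,
  T′-at-0 φ T T-total
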